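{- Let $n=p_1^{m_1}p_2^{m_2}\cdots p_k^{m_k}$, where $p_1<p_2<\cdots<p_k$ are primes, $k\ge 2$, and $m_i>1$ for at least one $i$. Let $T=|V(\mathcal{E}_{\mathbb{Z}_n})|$. Then $$\dim(\mathcal{E}_{\mathbb{Z}_n})=\begin{cases} T-(2^k-1), & \text{if } m_i>1 \text{ for at least two } i,\\ T-(2^k-2), & \text{if } m_i>1 \text{ for exactly one } i.\end{cases}$$
   Context: An ideal of a commutative ring $R$ with unity is essential if it has nonzero intersection with every nonzero ideal of $R$. The essential ideal graph $\mathcal{E}_{R}$ is the simple graph whose vertices are the nonzero proper ideals of $R$, distinct $\hat I,\hat J$ adjacent iff $\hat I+\hat J$ is essential. Thus $T$ is the number of nonzero proper ideals of $\mathbb{Z}_n$, i.e. $T=\prod_{i=1}^k(m_i+1)-2$. For an ordered set $W=\{w_1,\dots,w_t\}$ of vertices of a connected graph $\Gamma$ and a vertex $v$, $r(v\mid W)=(d(v,w_1),\dots,d(v,w_t))$ with $d$ the graph distance; $W$ is resolving if $r(u\mid W)\ne r(v\mid W)$ for all distinct $u,v\notin W$. The metric dimension $\dim(\Gamma)$ is the minimum size of a resolving set. -}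

module Defs where

open import Data.Nat using (ℕ; zero; suc; _+_; _*_; _^_; _%_; _≤_; _<_; NonZero; _≡ᵇ_)
open import Data.Nat.DivMod using (m%n<n)
open import Data.Bool using (Bool; true; false; _∧_; _∨_; not; if_then_else_)
open import Data.Fin using (Fin; toℕ; fromℕ<)
open import Data.Fin.Subset using (Subset)
open import Data.Vec using (lookup; tabulate)
open import Data.List using (List; length)
open import Data.Bool.ListAction using (all; any)
open import Data.List.Base using (allFin)
open import Data.List.Membership.Propositional using (_∈_; _∉_)
open import Data.List.Relation.Unary.All using (All)
open import Data.List.Relation.Unary.Unique.Propositional using (Unique)
open import Data.Product using (Σ; ∃; ∃-syntax; _×_)
open import Relation.Binary.PropositionalEquality using (_≡_; _≢_)

prodFin : (k : ℕ) → (Fin k → ℕ) → ℕ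
prodFin zero f = 1
prodFin (suc k) f = f Fin.zero * prodFin k (λ i → f (Fin.suc i))

module ℤₙ (n : ℕ) .{{_ : NonZero n}} where

  ι : ℕ → Fin n
  ι x = fromℕ< (m%n<n x n)

  0ₙ 1ₙ : Fin n
  0ₙ = ι 0
  1ₙ = ι 1

  _+ₙ_ _*ₙ_ : Fin n → Fin n → Fin n
  a +ₙ b = ι (toℕ a + toℕ b)
  a *ₙ b = ι (toℕ a * toℕ b)

  allᶠ anyᶠ : (Fin n → Bool) → Bool
  allᶠ P = all P (allFin n)
  anyᶠ P = any P (allFin n)

  eqᶠ : Fin n → Fin n → Bool
  eqᶠ a b = toℕ a ≡ᵇ toℕ b

  _⇒ᵇ_ : Bool → Bool → Bool
  a ⇒ᵇ b = not a ∨ b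

  -- A subset S of ℤ_n (as a Bool-vector) is an ideal: contains 0, closed
  -- under addition and under multiplication by ring elements (the latter
  -- with r = -1 gives closure under negation).
  isIdealᵇ : Subset n → Bool
  isIdealᵇ S =
    lookup S 0ₙ
    ∧ allᶠ (λ a → allᶠ (λ b → (lookup S a ∧ lookup S b) ⇒ᵇ lookup S (a +ₙ b)))
    ∧ allᶠ (λ r → allᶠ (λ a → lookup S a ⇒ᵇ lookup S (r *ₙ a)))

  nonzeroᵇ : Subset n → Bool
  nonzeroᵇ S = anyᶠ (λ x → lookup S x ∧ not (eqᶠ x 0ₙ))

  properᵇ : Subset n → Bool
  properᵇ S = not (allᶠ (λ x → lookup S x))

  isVertexᵇ : Subset n → Bool
  isVertexᵇ S = isIdealᵇ S ∧ nonzeroᵇ S ∧ properᵇ S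

  IsIdeal IsVertex : Subset n → Set
  IsIdeal S = isIdealᵇ S ≡ true
  IsVertex S = isVertexᵇ S ≡ true

  Vertex : Set
  Vertex = Σ (Subset n) IsVertex

  _⊕_ _∩_ : Subset n → Subset n → Subset n
  I ⊕ J = tabulate (λ x → anyᶠ (λ a → anyᶠ (λ b → lookup I a ∧ lookup J b ∧ eqᶠ (a +ₙ b) x)))
  I ∩ J = tabulate (λ x → lookup I x ∧ lookup J x)

  Essential : Subset n → Set
  Essential I = (J : Subset n) → IsIdeal J → nonzeroᵇ J ≡ true → nonzeroᵇ (I ∩ J) ≡ true

  Adj : Subset n → Subset n → Set
  Adj I J = IsVertex I × IsVertex J × I ≢ J × Essential (I ⊕ J)

  data Walk : Subset n → Subset n → ℕ → Set where
    here : ∀ {u} → IsVertex u → Walk u u 0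
    step : ∀ {u w v k} → Adj u w → Walk w v k → Walk u v (suc k)

  Dist : Subset n → Subset n → ℕ → Set
  Dist u v d = Walk u v d × (∀ j → Walk u v j → d ≤ j)

  Resolving : List (Subset n) → Set
  Resolving W =
    All IsVertex W × Unique W ×
    (∀ u v → IsVertex u → IsVertex v → u ∉ W → v ∉ W → u ≢ v →
      ∃[ w ] (w ∈ W × ∃[ a ] ∃[ b ] (Dist u w a × Dist v w b × a ≢ b)))

  MetricDim : ℕ → Set
  MetricDim d =
    (∃[ W ] (Resolving W × length W ≡ d)) ×
    (∀ W → Resolving W → d ≤ length W)

module Submission where

-- The ideals of ℤ_N are the ⟨d⟩ with d ∣ N, and the minimal ones are spanned by the ε j = N / p j.
-- An ideal is essential iff it contains every ε j, so I and J are adjacent iff each ε j lies in I or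
-- in J. If p i₀ ^ 2 ∣ N, the vertex ⟨p i₀⟩ contains every ε j, so distinct vertices are at distance
-- 1 or 2, and the distance from u to w depends on u only through its defect {j ∣ ε j ∉ u}. Vertices
-- with equal defect are twins, so a resolving set omits at most one vertex from each of the 2^k − 1
-- possible defects. Conversely, all vertices but one representative per defect resolve, provided for
-- each j some non-representative has defect exactly {j}: for two indices with m > 1 there are two such
-- vertices, ⟨p j ^ m j⟩ and ⟨p j ^ m j * p l⟩. If only m i > 1, a vertex without ε i is determined by
-- its defect; a vertex of W separating the defects ∅ and {i} is of this kind, which costs one more class.

open import Defs
open import Axiom.UniquenessOfIdentityProofs using (module Decidable⇒UIP)
open import Data.Bool using (Bool; true; false; _∧_; not; if_then_else_)
open import Data.Bool.ListAction using (all; any)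
open import Data.Bool.Properties using (∧-conicalˡ; ∧-conicalʳ; not-injective; ¬-not)
import Data.Bool.Properties as Boolₚ
open import Data.Empty using (⊥-elim)
open import Data.Fin using (Fin; toℕ) renaming (zero to fzero; suc to fsuc; _<_ to _<ᶠ_)
open import Data.Fin.Properties using (toℕ-fromℕ<; toℕ-injective; toℕ<n; ¬∀⟶∃¬; all?) renaming (_≟_ to _≟ᶠ_; <-cmp to <ᶠ-cmp)
open import Data.Fin.Subset using (Subset; ⊤; ⊥; ⁅_⁆)
open import Data.Fin.Subset.Properties using (x∈⁅x⁆; x∈⁅y⁆⇒x≡y)
open import Data.List using (List; []; _∷_; length; map; _++_; filter; foldr; allFin)
open import Data.List.Properties using (length-++; length-map; length-tabulate; filter-notAll)
open import Data.List.Membership.Propositional using (_∈_; _∉_; find)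
open import Data.List.Membership.Propositional.Properties
  using (∈-allFin; ∈-map⁺; ∈-map⁻; ∈-++⁺ˡ; ∈-++⁺ʳ; ∈-++⁻; ∈-filter⁺; ∈-filter⁻)
open import Data.List.Relation.Unary.All as All using (All)
open import Data.List.Relation.Unary.Any as Any using (here; there)
open import Data.List.Relation.Unary.AllPairs using ([]; _∷_)
open import Data.List.Relation.Unary.Unique.Propositional using (Unique)
import Data.List.Relation.Unary.Unique.Propositional.Properties as Uniqueₚ
open import Data.Nat using (ℕ; zero; suc; pred; _+_; _*_; _∸_; _^_; _%_; _≤_; _<_; _≡ᵇ_; z≤n; s≤s; z<s; NonZero; _≤?_)
open import Data.Nat.Base using (nonTrivial⇒n>1; >-nonZero)
open import Data.Nat.Properties
open import Data.Nat.Divisibility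
open import Data.Nat.DivMod using (m%n<n; m<n⇒m%n≡m; %-distribˡ-+; %-distribˡ-*; n%n≡0; [m+kn]%n≡m%n)
open import Data.Nat.Coprimality using (Coprime; coprime-divisor) renaming (sym to coprime-sym)
open import Data.Nat.GCD using (gcd; gcd[m,n]∣m; gcd[m,n]∣n; gcd-GCD; module Bézout)
open import Data.Nat.Primality using (Prime; prime⇒irreducible; prime⇒nonTrivial)
open import Data.Product using (∃-syntax; _×_; _,_; proj₁; proj₂)
open import Data.Sum using (_⊎_; inj₁; inj₂; map₁; swap)
import Data.Sum.Properties as Sumₚ
open import Data.Vec as Vec using (Vec; lookup; tabulate)
open import Data.Vec.Properties
  using (lookup∘tabulate; tabulate∘lookup; tabulate-cong; lookup-replicate; ≡-dec; lookup⇒[]=; []=⇒lookup; ∷-injectiveʳ)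
open import Data.Vec.Functional using (updateAt)
open import Data.Vec.Functional.Properties using (updateAt-updates; updateAt-minimal)
open import Function using (_∘_; const; _∋_)
open import Function.Bundles using (_↔_; Inverse; Equivalence)
open import Relation.Binary.Definitions using (DecidableEquality; tri<; tri≈; tri>)
open import Relation.Binary.PropositionalEquality
  using (_≡_; _≢_; refl; sym; trans; cong; cong₂; subst; subst₂; module ≡-Reasoning)
open import Relation.Nullary using (¬_; Dec; yes; no; ¬?; does)
open import Relation.Nullary.Decidable using (_×-dec_; dec-true; dec-false)

module _ {a} {A : Set a} (P : A → Bool) where

  all-true⁻ : ∀ xs → all P xs ≡ true → ∀ {x} → x ∈ xs → P x ≡ true
  all-true⁻ (y ∷ ys) e (here refl) = ∧-conicalˡ _ _ e
  all-true⁻ (y ∷ ys) e (there x∈) = all-true⁻ ys (∧-conicalʳ _ _ e) x∈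

  all-true⁺ : ∀ xs → (∀ {x} → x ∈ xs → P x ≡ true) → all P xs ≡ true
  all-true⁺ [] h = refl
  all-true⁺ (y ∷ ys) h = cong₂ _∧_ (h (here refl)) (all-true⁺ ys (h ∘ there))

  all-false⁺ : ∀ xs {x} → x ∈ xs → P x ≡ false → all P xs ≡ false
  all-false⁺ (y ∷ ys) (here refl) e rewrite e = refl
  all-false⁺ (y ∷ ys) (there x∈) e with P y
  ... | true = all-false⁺ ys x∈ e
  ... | false = refl

  any-true⁻ : ∀ xs → any P xs ≡ true → ∃[ x ] (x ∈ xs × P x ≡ true)
  any-true⁻ (y ∷ ys) e with P y in eq
  ... | true = y , here refl , eq
  ... | false with any-true⁻ ys e
  ... | x , x∈ , px = x , there x∈ , px

  any-true⁺ : ∀ xs {x} → x ∈ xs → P x ≡ true → any P xs ≡ true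
  any-true⁺ (y ∷ ys) (here refl) e rewrite e = refl
  any-true⁺ (y ∷ ys) (there x∈) e with P y
  ... | true = refl
  ... | false = any-true⁺ ys x∈ e

module Remove {b} {B : Set b} (_≟_ : DecidableEquality B) where

  remove : B → List B → List B
  remove y = filter (λ z → ¬? (y ≟ z))

  ∈-remove⁺ : ∀ {y z ys} → z ∈ ys → z ≢ y → z ∈ remove y ys
  ∈-remove⁺ z∈ z≢y = ∈-filter⁺ _ z∈ (z≢y ∘ sym)

  ∈-remove⁻ : ∀ {y z} ys → z ∈ remove y ys → z ∈ ys × z ≢ y
  ∈-remove⁻ ys z∈ = let (z∈ys , y≢z) = ∈-filter⁻ _ {xs = ys} z∈ in z∈ys , y≢z ∘ sym

  length-remove : ∀ {y} ys → y ∈ ys → suc (length (remove y ys)) ≤ length ys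
  length-remove ys y∈ = filter-notAll (λ z → ¬? (_ ≟ z)) ys (Any.map (λ y≡z y≢z → y≢z y≡z) y∈)

  remove-unique : ∀ {y ys} → Unique ys → Unique (remove y ys)
  remove-unique = Uniqueₚ.filter⁺ _

  injective⇒length≤ : ∀ {a} {A : Set a} (f : A → B) (xs : List A) (ys : List B) → Unique xs →
                      (∀ {x x'} → x ∈ xs → x' ∈ xs → f x ≡ f x' → x ≡ x') →
                      (∀ {x} → x ∈ xs → f x ∈ ys) → length xs ≤ length ys
  injective⇒length≤ f [] ys _ _ _ = z≤n
  injective⇒length≤ f (x ∷ xs) ys (x∉xs ∷ xs-unique) inj f∈ =
    ≤-trans (s≤s (injective⇒length≤ f xs (remove (f x) ys) xs-unique (λ u v → inj (there u) (there v)) f∈rest))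
            (length-remove ys (f∈ (here refl)))
    where
    f∈rest : ∀ {x'} → x' ∈ xs → f x' ∈ remove (f x) ys
    f∈rest x'∈ = ∈-remove⁺ (f∈ (there x'∈)) (λ e → All.lookup x∉xs x'∈ (sym (inj (there x'∈) (here refl) e)))

  unique⊆⇒length≤ : ∀ (xs ys : List B) → Unique xs → (∀ {x} → x ∈ xs → x ∈ ys) → length xs ≤ length ys
  unique⊆⇒length≤ xs ys u = injective⇒length≤ (λ x → x) xs ys u (λ _ _ e → e)

allSubsets : ∀ k → List (Subset k)
allSubsets zero = Vec.[] ∷ []
allSubsets (suc k) = map (true Vec.∷_) (allSubsets k) ++ map (false Vec.∷_) (allSubsets k)

length-allSubsets : ∀ k → length (allSubsets k) ≡ 2 ^ k
length-allSubsets zero = refl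
length-allSubsets (suc k) = begin
  length (map (true Vec.∷_) S ++ map (false Vec.∷_) S)          ≡⟨ length-++ (map (true Vec.∷_) S) ⟩
  length (map (true Vec.∷_) S) + length (map (false Vec.∷_) S)  ≡⟨ cong₂ _+_ (length-map _ S) (length-map _ S) ⟩
  length S + length S                                           ≡⟨ cong₂ _+_ (length-allSubsets k) (trans (length-allSubsets k) (sym (+-identityʳ _))) ⟩
  2 ^ k + (2 ^ k + 0)                                           ∎
  where open ≡-Reasoning
        S = allSubsets k

∈-allSubsets : ∀ {k} (S : Subset k) → S ∈ allSubsets k
∈-allSubsets Vec.[] = here refl
∈-allSubsets (true Vec.∷ S) = ∈-++⁺ˡ (∈-map⁺ (true Vec.∷_) (∈-allSubsets S))
∈-allSubsets {suc k} (false Vec.∷ S) = ∈-++⁺ʳ (map (true Vec.∷_) (allSubsets k)) (∈-map⁺ (false Vec.∷_) (∈-allSubsets S))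

allSubsets-unique : ∀ k → Unique (allSubsets k)
allSubsets-unique zero = All.[] ∷ []
allSubsets-unique (suc k) =
  Uniqueₚ.++⁺ (Uniqueₚ.map⁺ ∷-injectiveʳ (allSubsets-unique k)) (Uniqueₚ.map⁺ ∷-injectiveʳ (allSubsets-unique k)) disjoint
  where
  disjoint : ∀ {v} → ¬ (v ∈ map (true Vec.∷_) (allSubsets k) × v ∈ map (false Vec.∷_) (allSubsets k))
  disjoint (v∈₁ , v∈₂) with ∈-map⁻ (true Vec.∷_) v∈₁ | ∈-map⁻ (false Vec.∷_) v∈₂
  ... | _ , _ , refl | _ , _ , ()

lookup-⁅⁆ : ∀ {k} (i : Fin k) → lookup ⁅ i ⁆ i ≡ true
lookup-⁅⁆ i = []=⇒lookup (x∈⁅x⁆ i)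

lookup-⁅⁆-≢ : ∀ {k} {i j : Fin k} → j ≢ i → lookup ⁅ i ⁆ j ≡ false
lookup-⁅⁆-≢ {i = i} {j} j≢i = ¬-not (λ e → j≢i (x∈⁅y⁆⇒x≡y i (lookup⇒[]= j ⁅ i ⁆ e)))

true≢false : true ≢ false
true≢false ()

⊥≢⁅⁆ : ∀ {k} (i : Fin k) → ⊥ ≢ ⁅ i ⁆
⊥≢⁅⁆ i ⊥≡⁅i⁆ = true≢false (trans (sym (lookup-⁅⁆ i)) (trans (cong (λ D → lookup D i) (sym ⊥≡⁅i⁆)) (lookup-replicate i false)))

⁅⁆≢⊤ : ∀ {k} {i l : Fin k} → l ≢ i → ⁅ i ⁆ ≢ ⊤
⁅⁆≢⊤ {l = l} l≢i ⁅i⁆≡⊤ = true≢false (trans (sym (lookup-replicate l true)) (trans (cong (λ D → lookup D l) (sym ⁅i⁆≡⊤)) (lookup-⁅⁆-≢ l≢i)))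

⊥≢⊤ : ∀ {k} → Fin k → ⊥ ≢ ⊤
⊥≢⊤ i ⊥≡⊤ = true≢false (trans (sym (lookup-replicate i true)) (trans (cong (λ D → lookup D i) (sym ⊥≡⊤)) (lookup-replicate i false)))

otherIndex : ∀ {k} → 2 ≤ k → (i : Fin k) → ∃[ l ] (l ≢ i)
otherIndex {suc (suc k)} _ fzero = fsuc fzero , λ ()
otherIndex {suc (suc k)} _ (fsuc i) = fzero , λ ()
otherIndex {suc zero} (s≤s ()) fzero

increasing⇒injective : ∀ {k} {p : Fin k → ℕ} → (∀ i j → i <ᶠ j → p i < p j) → ∀ i j → i ≢ j → p i ≢ p j
increasing⇒injective p-increasing i j i≢j pᵢ≡pⱼ with <ᶠ-cmp i j
... | tri< i<j _ _ = <⇒≢ (p-increasing i j i<j) pᵢ≡pⱼ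
... | tri≈ _ i≡j _ = i≢j i≡j
... | tri> _ _ j<i = <⇒≢ (p-increasing j i j<i) (sym pᵢ≡pⱼ)

lookup-extensional : ∀ {A : Set} {r} (u v : Vec A r) → (∀ x → lookup u x ≡ lookup v x) → u ≡ v
lookup-extensional u v h = trans (sym (tabulate∘lookup u)) (trans (tabulate-cong h) (tabulate∘lookup v))

prime>1 : ∀ {q} → Prime q → 1 < q
prime>1 {q} q-prime = nonTrivial⇒n>1 q {{prime⇒nonTrivial q-prime}}

prime-≢⇒coprime : ∀ {a b} → Prime a → Prime b → a ≢ b → Coprime a b
prime-≢⇒coprime a-prime b-prime a≢b {d} (d∣a , d∣b) with prime⇒irreducible a-prime d∣a
... | inj₁ d≡1 = d≡1
... | inj₂ refl with prime⇒irreducible b-prime d∣b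
...   | inj₁ d≡1 = ⊥-elim (<⇒≢ (prime>1 a-prime) (sym d≡1))
...   | inj₂ d≡b = ⊥-elim (a≢b d≡b)

prime-∤⇒coprime : ∀ {q h} → Prime q → ¬ q ∣ h → Coprime q h
prime-∤⇒coprime q-prime q∤h {d} (d∣q , d∣h) with prime⇒irreducible q-prime d∣q
... | inj₁ d≡1 = d≡1
... | inj₂ refl = ⊥-elim (q∤h d∣h)

coprime-1ʳ : ∀ c → Coprime c 1
coprime-1ʳ c (_ , d∣1) = ∣1⇒≡1 d∣1

coprime-*ʳ : ∀ {c x y} → Coprime c x → Coprime c y → Coprime c (x * y)
coprime-*ʳ {c} {x} {y} c⊥x c⊥y {d} (d∣c , d∣xy) = c⊥y (d∣c , coprime-divisor d⊥x d∣xy)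
  where d⊥x : Coprime d x
        d⊥x (e∣d , e∣x) = c⊥x (∣-trans e∣d d∣c , e∣x)

coprime-^ʳ : ∀ {c x} e → Coprime c x → Coprime c (x ^ e)
coprime-^ʳ zero c⊥x = coprime-1ʳ _
coprime-^ʳ (suc e) c⊥x = coprime-*ʳ c⊥x (coprime-^ʳ e c⊥x)

coprime-^ : ∀ {x y} a b → Coprime x y → Coprime (x ^ a) (y ^ b)
coprime-^ a b x⊥y = coprime-sym (coprime-^ʳ a (coprime-sym (coprime-^ʳ b x⊥y)))

^-monoʳ-∣ : ∀ q {e f} → e ≤ f → q ^ e ∣ q ^ f
^-monoʳ-∣ q {e} {f} e≤f = divides (q ^ (f ∸ e)) (begin
  q ^ f                ≡⟨ cong (q ^_) (sym (m∸n+n≡m e≤f)) ⟩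
  q ^ (f ∸ e + e)      ≡⟨ ^-distribˡ-+-* q (f ∸ e) e ⟩
  q ^ (f ∸ e) * q ^ e  ∎)
  where open ≡-Reasoning

^-∣⇒≤ : ∀ {q} → 1 < q → ∀ t e → q ^ t ∣ q ^ e → t ≤ e
^-∣⇒≤ {q} q>1 t e q^t∣q^e with t ≤? e
... | yes t≤e = t≤e
... | no t≰e = ⊥-elim (<⇒≱ (^-monoʳ-< q q>1 (≰⇒> t≰e)) (∣⇒≤ {{m^n≢0 q e {{>-nonZero (<-trans z<s q>1)}}}} q^t∣q^e))

prodFin-cong : ∀ k (f g : Fin k → ℕ) → (∀ i → f i ≡ g i) → prodFin k f ≡ prodFin k g
prodFin-cong zero f g h = refl
prodFin-cong (suc k) f g h = cong₂ _*_ (h fzero) (prodFin-cong k _ _ (h ∘ fsuc))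

prodFin-* : ∀ k (f g : Fin k → ℕ) → prodFin k (λ i → f i * g i) ≡ prodFin k f * prodFin k g
prodFin-* zero f g = refl
prodFin-* (suc k) f g rewrite prodFin-* k (f ∘ fsuc) (g ∘ fsuc) =
  *-assoc-middle (f fzero) (g fzero) (prodFin k (f ∘ fsuc)) (prodFin k (g ∘ fsuc))
  where
  *-assoc-middle : ∀ a b c d → a * b * (c * d) ≡ a * c * (b * d)
  *-assoc-middle a b c d = begin
    a * b * (c * d)  ≡⟨ *-assoc a b (c * d) ⟩
    a * (b * (c * d)) ≡⟨ cong (a *_) (trans (sym (*-assoc b c d)) (trans (cong (_* d) (*-comm b c)) (*-assoc c b d))) ⟩
    a * (c * (b * d)) ≡⟨ sym (*-assoc a c (b * d)) ⟩
    a * c * (b * d)  ∎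
    where open ≡-Reasoning

prodFin-pos : ∀ k (f : Fin k → ℕ) → (∀ i → 0 < f i) → 0 < prodFin k f
prodFin-pos zero f h = z<s
prodFin-pos (suc k) f h = *-mono-< (h fzero) (prodFin-pos k _ (h ∘ fsuc))

∣-prodFin : ∀ k (f : Fin k → ℕ) i → f i ∣ prodFin k f
∣-prodFin (suc k) f fzero = m∣m*n _
∣-prodFin (suc k) f (fsuc i) = ∣n⇒∣m*n (f fzero) (∣-prodFin k (f ∘ fsuc) i)

prodFin-mono-∣ : ∀ k (f g : Fin k → ℕ) → (∀ i → f i ∣ g i) → prodFin k f ∣ prodFin k g
prodFin-mono-∣ zero f g h = ∣-refl
prodFin-mono-∣ (suc k) f g h = *-pres-∣ (h fzero) (prodFin-mono-∣ k _ _ (h ∘ fsuc))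

coprime-prodFin : ∀ k (f : Fin k → ℕ) {c} → (∀ i → Coprime c (f i)) → Coprime c (prodFin k f)
coprime-prodFin zero f h = coprime-1ʳ _
coprime-prodFin (suc k) f h = coprime-*ʳ (h fzero) (coprime-prodFin k (f ∘ fsuc) (h ∘ fsuc))

fsuc-injective : ∀ {k} {i j : Fin k} → fsuc i ≡ fsuc j → i ≡ j
fsuc-injective refl = refl

pairwiseCoprime-∣⇒prodFin-∣ : ∀ k (f : Fin k → ℕ) {x} → (∀ i j → i ≢ j → Coprime (f i) (f j)) →
                              (∀ i → f i ∣ x) → prodFin k f ∣ x
pairwiseCoprime-∣⇒prodFin-∣ zero f f-coprime f∣x = 1∣ _
pairwiseCoprime-∣⇒prodFin-∣ (suc k) f {x} f-coprime f∣x with rest∣x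
  where
  rest∣x : prodFin k (f ∘ fsuc) ∣ x
  rest∣x = pairwiseCoprime-∣⇒prodFin-∣ k (f ∘ fsuc) (λ i j i≢j → f-coprime (fsuc i) (fsuc j) (i≢j ∘ fsuc-injective)) (f∣x ∘ fsuc)
... | divides t x≡tR = subst (f fzero * R ∣_) (sym x≡tR) (subst (_∣ t * R) (*-comm R (f fzero)) R*f₀∣t*R)
  where
  R = prodFin k (f ∘ fsuc)
  f₀⊥R : Coprime (f fzero) R
  f₀⊥R = coprime-prodFin k (f ∘ fsuc) (λ i → f-coprime fzero (fsuc i) (λ ()))
  f₀∣t : f fzero ∣ t
  f₀∣t = coprime-divisor f₀⊥R (subst (f fzero ∣_) (trans x≡tR (*-comm t R)) (f∣x fzero))
  R*f₀∣t*R : R * f fzero ∣ t * R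
  R*f₀∣t*R = subst (R * f fzero ∣_) (*-comm R t) (*-monoʳ-∣ R f₀∣t)

prodFin-updateAt : ∀ k (f : Fin k → ℕ) j {c x} → f j ≡ c * x →
                   prodFin k f ≡ c * prodFin k (updateAt f j (const x))
prodFin-updateAt (suc k) f fzero {c} {x} fj≡cx = trans (cong (_* prodFin k (f ∘ fsuc)) fj≡cx) (*-assoc c x _)
prodFin-updateAt (suc k) f (fsuc j) {c} {x} fj≡cx = begin
  f fzero * prodFin k (f ∘ fsuc)       ≡⟨ cong (f fzero *_) (prodFin-updateAt k (f ∘ fsuc) j {c} {x} fj≡cx) ⟩
  f fzero * (c * R)                    ≡⟨ sym (*-assoc (f fzero) c R) ⟩
  f fzero * c * R                      ≡⟨ cong (_* R) (*-comm (f fzero) c) ⟩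
  c * f fzero * R                      ≡⟨ *-assoc c (f fzero) R ⟩
  c * (f fzero * R)                    ∎
  where open ≡-Reasoning
        R = prodFin k (updateAt (f ∘ fsuc) j (const x))

module Factorisation (k : ℕ) (p m : Fin k → ℕ) (p-prime : ∀ i → Prime (p i))
                     (p-coprime : ∀ i j → i ≢ j → Coprime (p i) (p j)) (m≥1 : ∀ i → 1 ≤ m i) where

  p>1 : ∀ i → 1 < p i
  p>1 i = prime>1 (p-prime i)

  p^e>0 : ∀ i e → 0 < p i ^ e
  p^e>0 i e = m^n>0 (p i) {{>-nonZero (<-trans z<s (p>1 i))}} e

  p≤p^e : ∀ i e → 1 ≤ e → p i ≤ p i ^ e
  p≤p^e i (suc e) _ = subst (_≤ p i ^ suc e) (*-identityʳ (p i)) (*-monoʳ-≤ (p i) (p^e>0 i e))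

  prodPow : (Fin k → ℕ) → ℕ
  prodPow E = prodFin k (λ i → p i ^ E i)

  N : ℕ
  N = prodPow m

  primePower : Fin k → ℕ
  primePower j = p j ^ m j

  prodPow>0 : ∀ E → 0 < prodPow E
  prodPow>0 E = prodFin-pos k _ (λ i → p^e>0 i (E i))

  p^t∣prodPow⇒t≤ : ∀ E j t → p j ^ t ∣ prodPow E → t ≤ E j
  p^t∣prodPow⇒t≤ E j t p^t∣ = ^-∣⇒≤ (p>1 j) t (E j) (coprime-divisor p^t⊥R (subst (p j ^ t ∣_) split p^t∣))
    where
    R = prodFin k (updateAt (λ i → p i ^ E i) j (const 1))
    split : prodPow E ≡ R * p j ^ E j
    split = trans (prodFin-updateAt k _ j {p j ^ E j} {1} (sym (*-identityʳ _))) (*-comm _ R)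
    p^t⊥R : Coprime (p j ^ t) R
    p^t⊥R = coprime-prodFin k _ p^t⊥factor
      where p^t⊥factor : ∀ i → Coprime (p j ^ t) (updateAt (λ i → p i ^ E i) j (const 1) i)
            p^t⊥factor i with i ≟ᶠ j
            ... | yes refl = subst (Coprime _) (sym (updateAt-updates j _)) (coprime-1ʳ _)
            ... | no i≢j = subst (Coprime _) (sym (updateAt-minimal i j _ i≢j)) (coprime-^ t (E i) (p-coprime j i (i≢j ∘ sym)))

  primePower∣prodPow⇒≡ : ∀ E → (∀ i → E i ≤ m i) → ∀ j → primePower j ∣ prodPow E → E j ≡ m j
  primePower∣prodPow⇒≡ E E≤m j d = ≤-antisym (E≤m j) (p^t∣prodPow⇒t≤ E j (m j) d)

  ≡⇒primePower∣prodPow : ∀ E j → E j ≡ m j → primePower j ∣ prodPow E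
  ≡⇒primePower∣prodPow E j Ej≡mj = subst (λ x → p j ^ x ∣ prodPow E) Ej≡mj (∣-prodFin k _ j)

  prodPow∣N : ∀ E → (∀ i → E i ≤ m i) → prodPow E ∣ N
  prodPow∣N E E≤m = prodFin-mono-∣ k _ _ (λ i → ^-monoʳ-∣ (p i) (E≤m i))

  primePower∣N : ∀ j → primePower j ∣ N
  primePower∣N = ∣-prodFin k primePower

  primePower-coprime : ∀ i j → i ≢ j → Coprime (primePower i) (primePower j)
  primePower-coprime i j i≢j = coprime-^ (m i) (m j) (p-coprime i j i≢j)

  primePowers∣⇒N∣ : ∀ {x} → (∀ j → primePower j ∣ x) → N ∣ x
  primePowers∣⇒N∣ = pairwiseCoprime-∣⇒prodFin-∣ k primePower primePower-coprime

  -- N / p j, written so that N ≡ p j * cofactor j holds without division.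
  cofactor : Fin k → ℕ
  cofactor j = prodFin k (updateAt primePower j (const (p j ^ (m j ∸ 1))))

  N≡p*cofactor : ∀ j → N ≡ p j * cofactor j
  N≡p*cofactor j = prodFin-updateAt k primePower j {p j} {p j ^ (m j ∸ 1)}
                     (cong (p j ^_) (sym (trans (+-comm 1 (m j ∸ 1)) (m∸n+n≡m (m≥1 j)))))

  cofactor>0 : ∀ j → 0 < cofactor j
  cofactor>0 j = *-cancelˡ-< (p j) 0 (cofactor j) (subst (p j * 0 <_) (N≡p*cofactor j) (subst (_< N) (sym (*-zeroʳ (p j))) (prodPow>0 m)))

  cofactor∣N : ∀ j → cofactor j ∣ N
  cofactor∣N j = divides (p j) (N≡p*cofactor j)

  primePower∤cofactor : ∀ j → ¬ primePower j ∣ cofactor j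
  primePower∤cofactor j d = 1+n≰n (p^t∣prodPow⇒t≤ m j (suc (m j)) (subst (p j * primePower j ∣_) (sym (N≡p*cofactor j)) (*-monoʳ-∣ (p j) d)))

  ∣N∧primePower∤⇒∣cofactor : ∀ j {g} → g ∣ N → ¬ primePower j ∣ g → g ∣ cofactor j
  ∣N∧primePower∤⇒∣cofactor j {g} (divides h N≡hg) pp∤g with p j ∣? h
  ... | yes (divides h' h≡h'p) = divides h' (*-cancelˡ-≡ (cofactor j) (h' * g) (p j) {{>-nonZero (<-trans z<s (p>1 j))}} (begin
        p j * cofactor j ≡⟨ sym (N≡p*cofactor j) ⟩
        N                ≡⟨ N≡hg ⟩
        h * g            ≡⟨ cong (_* g) (trans h≡h'p (*-comm h' (p j))) ⟩
        p j * h' * g     ≡⟨ *-assoc (p j) h' g ⟩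
        p j * (h' * g)   ∎))
    where open ≡-Reasoning
  ... | no p∤h = ⊥-elim (pp∤g (coprime-divisor pp⊥h (subst (primePower j ∣_) N≡hg (primePower∣N j))))
    where pp⊥h : Coprime (primePower j) h
          pp⊥h = coprime-sym (coprime-^ʳ (m j) (coprime-sym (prime-∤⇒coprime (p-prime j) p∤h)))

  cofactor∣∧primePower∣⇒N∣ : ∀ j {z} → cofactor j ∣ z → primePower j ∣ z → N ∣ z
  cofactor∣∧primePower∣⇒N∣ j {z} (divides t z≡tc) pp∣z with p j ∣? t
  ... | yes (divides t' t≡t'p) = divides t' (begin
        z                    ≡⟨ z≡tc ⟩
        t * cofactor j       ≡⟨ cong (_* cofactor j) t≡t'p ⟩
        t' * p j * cofactor j ≡⟨ *-assoc t' (p j) (cofactor j) ⟩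
        t' * (p j * cofactor j) ≡⟨ cong (t' *_) (sym (N≡p*cofactor j)) ⟩
        t' * N               ∎)
    where open ≡-Reasoning
  ... | no p∤t = ⊥-elim (primePower∤cofactor j (coprime-divisor pp⊥t (subst (primePower j ∣_) z≡tc pp∣z)))
    where pp⊥t : Coprime (primePower j) t
          pp⊥t = coprime-sym (coprime-^ʳ (m j) (coprime-sym (prime-∤⇒coprime (p-prime j) p∤t)))

module IdealsOfℤₙ (n : ℕ) .{{_ : NonZero n}} where
  open ℤₙ n

  toℕ-ι : ∀ x → toℕ (ι x) ≡ x % n
  toℕ-ι x = toℕ-fromℕ< (m%n<n x n)

  toℕ-ι< : ∀ {x} → x < n → toℕ (ι x) ≡ x
  toℕ-ι< x<n = trans (toℕ-ι _) (m<n⇒m%n≡m x<n)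

  ι-toℕ : ∀ (y : Fin n) → ι (toℕ y) ≡ y
  ι-toℕ y = toℕ-injective (toℕ-ι< (toℕ<n y))

  ι-cong-% : ∀ {x y} → x % n ≡ y % n → ι x ≡ ι y
  ι-cong-% e = toℕ-injective (trans (toℕ-ι _) (trans e (sym (toℕ-ι _))))

  ι-+ : ∀ x y → ι x +ₙ ι y ≡ ι (x + y)
  ι-+ x y = ι-cong-% (trans (cong₂ (λ a b → (a + b) % n) (toℕ-ι x) (toℕ-ι y)) (sym (%-distribˡ-+ x y n)))

  ι-* : ∀ x y → ι x *ₙ ι y ≡ ι (x * y)
  ι-* x y = ι-cong-% (trans (cong₂ (λ a b → (a * b) % n) (toℕ-ι x) (toℕ-ι y)) (sym (%-distribˡ-* x y n)))

  ι-+-multiple : ∀ d c → ι (d + c * n) ≡ ι d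
  ι-+-multiple d c = ι-cong-% ([m+kn]%n≡m%n d c n)

  ι-n : ι n ≡ 0ₙ
  ι-n = ι-cong-% (trans (n%n≡0 n) (sym (0%n n)))
    where 0%n : ∀ n .{{_ : NonZero n}} → 0 % n ≡ 0
          0%n (suc n) = refl

  infix 4 _∈ₛ_
  _∈ₛ_ : Fin n → Subset n → Set
  x ∈ₛ S = lookup S x ≡ true

  allᶠ-true⁻ : ∀ P → allᶠ P ≡ true → ∀ x → P x ≡ true
  allᶠ-true⁻ P e x = all-true⁻ P (allFin n) e (∈-allFin x)

  allᶠ-true⁺ : ∀ P → (∀ x → P x ≡ true) → allᶠ P ≡ true
  allᶠ-true⁺ P h = all-true⁺ P (allFin n) (λ {x} _ → h x)

  anyᶠ-true⁻ : ∀ P → anyᶠ P ≡ true → ∃[ x ] (P x ≡ true)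
  anyᶠ-true⁻ P e = let (x , _ , px) = any-true⁻ P (allFin n) e in x , px

  anyᶠ-true⁺ : ∀ P x → P x ≡ true → anyᶠ P ≡ true
  anyᶠ-true⁺ P x px = any-true⁺ P (allFin n) (∈-allFin x) px

  ⇒ᵇ-true⁻ : ∀ {a b} → (a ⇒ᵇ b) ≡ true → a ≡ true → b ≡ true
  ⇒ᵇ-true⁻ {true} e refl = e

  ⇒ᵇ-true⁺ : ∀ {a b} → (a ≡ true → b ≡ true) → (a ⇒ᵇ b) ≡ true
  ⇒ᵇ-true⁺ {true} h = h refl
  ⇒ᵇ-true⁺ {false} h = refl

  record Ideal (S : Subset n) : Set where
    field
      0∈ : 0ₙ ∈ₛ S
      +-closed : ∀ x y → x ∈ₛ S → y ∈ₛ S → x +ₙ y ∈ₛ S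
      *-closed : ∀ r x → x ∈ₛ S → r *ₙ x ∈ₛ S

  isIdeal⇒Ideal : ∀ S → IsIdeal S → Ideal S
  isIdeal⇒Ideal S e = record
    { 0∈ = ∧-conicalˡ (lookup S 0ₙ) _ e
    ; +-closed = λ x y x∈ y∈ → ⇒ᵇ-true⁻ (allᶠ-true⁻ _ (allᶠ-true⁻ _ (∧-conicalˡ _ _ closure) x) y) (cong₂ _∧_ x∈ y∈)
    ; *-closed = λ r x x∈ → ⇒ᵇ-true⁻ (allᶠ-true⁻ _ (allᶠ-true⁻ _ (∧-conicalʳ _ _ closure) r) x) x∈ }
    where closure = ∧-conicalʳ (lookup S 0ₙ) _ e

  Ideal⇒isIdeal : ∀ S → Ideal S → IsIdeal S
  Ideal⇒isIdeal S I = cong₂ _∧_ 0∈ (cong₂ _∧_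
    (allᶠ-true⁺ _ (λ x → allᶠ-true⁺ _ (λ y → ⇒ᵇ-true⁺ (λ h → +-closed x y (∧-conicalˡ (lookup S x) _ h) (∧-conicalʳ (lookup S x) _ h)))))
    (allᶠ-true⁺ _ (λ r → allᶠ-true⁺ _ (λ x → ⇒ᵇ-true⁺ (*-closed r x)))))
    where open Ideal I

  -- An ideal containing X and Y contains d whenever d + βY = αX: subtract βY as (n - 1)βY.
  bézout-closed : ∀ {S} → Ideal S → ∀ X Y d α β → ι X ∈ₛ S → ι Y ∈ₛ S → d + β * Y ≡ α * X → ι d ∈ₛ S
  bézout-closed {S} I X Y d α β X∈ Y∈ bézout =
    subst (_∈ₛ S) combination≡d (+-closed _ _ (*-closed (ι α) (ι X) X∈) (*-closed (ι (pred n * β)) (ι Y) Y∈))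
    where
    open Ideal I
    open ≡-Reasoning
    b = β * Y
    arith : α * X + pred n * β * Y ≡ d + b * n
    arith = begin
      α * X + pred n * β * Y   ≡⟨ cong₂ _+_ (sym bézout) (*-assoc (pred n) β Y) ⟩
      d + b + pred n * b       ≡⟨ +-assoc d b _ ⟩
      d + (b + pred n * b)     ≡⟨ cong (λ t → d + (b + t)) (*-comm (pred n) b) ⟩
      d + (b + b * pred n)     ≡⟨ cong (d +_) (sym (*-suc b (pred n))) ⟩
      d + b * suc (pred n)     ≡⟨ cong (λ t → d + b * t) (suc-pred n) ⟩
      d + b * n                ∎
    combination≡d : (ι α *ₙ ι X) +ₙ (ι (pred n * β) *ₙ ι Y) ≡ ι d
    combination≡d = begin
      (ι α *ₙ ι X) +ₙ (ι (pred n * β) *ₙ ι Y) ≡⟨ cong₂ _+ₙ_ (ι-* α X) (ι-* _ Y) ⟩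
      ι (α * X) +ₙ ι (pred n * β * Y)         ≡⟨ ι-+ _ _ ⟩
      ι (α * X + pred n * β * Y)              ≡⟨ cong ι arith ⟩
      ι (d + b * n)                           ≡⟨ ι-+-multiple d b ⟩
      ι d                                     ∎

  generatorOver : Subset n → List (Fin n) → ℕ
  generatorOver S = foldr (λ x g → if lookup S x then gcd (toℕ x) g else g) n

  record IsGeneratorOver (S : Subset n) (xs : List (Fin n)) (g : ℕ) : Set where
    field
      ∣n : g ∣ n
      ∣elements : ∀ {x} → x ∈ xs → x ∈ₛ S → g ∣ toℕ x
      ∈ideal : ι g ∈ₛ S

  generatorOver-correct : ∀ {S} → Ideal S → ∀ xs → IsGeneratorOver S xs (generatorOver S xs)
  generatorOver-correct {S} I [] = record { ∣n = ∣-refl ; ∣elements = λ () ; ∈ideal = subst (_∈ₛ S) (sym ι-n) (Ideal.0∈ I) }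
  generatorOver-correct {S} I (x ∷ xs) with lookup S x in x∈?
  ... | false = record { ∣n = ∣n ; ∣elements = ∣elements′ ; ∈ideal = ∈ideal }
    where
    open IsGeneratorOver (generatorOver-correct I xs)
    ∣elements′ : ∀ {y} → y ∈ x ∷ xs → y ∈ₛ S → generatorOver S xs ∣ toℕ y
    ∣elements′ (here refl) y∈ = ⊥-elim (Boolₚ.not-¬ x∈? y∈)
    ∣elements′ (there y∈xs) y∈ = ∣elements y∈xs y∈
  ... | true = record
      { ∣n = ∣-trans (gcd[m,n]∣n (toℕ x) g) ∣n
      ; ∣elements = λ { (here refl) _ → gcd[m,n]∣m (toℕ x) g ; (there y∈xs) y∈ → ∣-trans (gcd[m,n]∣n (toℕ x) g) (∣elements y∈xs y∈) }
      ; ∈ideal = gcd∈ (Bézout.identity (gcd-GCD (toℕ x) g)) }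
    where
    open IsGeneratorOver (generatorOver-correct I xs)
    g = generatorOver S xs
    x∈ : ι (toℕ x) ∈ₛ S
    x∈ = subst (_∈ₛ S) (sym (ι-toℕ x)) x∈?
    gcd∈ : Bézout.Identity (gcd (toℕ x) g) (toℕ x) g → ι (gcd (toℕ x) g) ∈ₛ S
    gcd∈ (Bézout.+- u v eq) = bézout-closed I (toℕ x) g _ u v x∈ ∈ideal eq
    gcd∈ (Bézout.-+ u v eq) = bézout-closed I g (toℕ x) _ v u ∈ideal x∈ eq

  generator : Subset n → ℕ
  generator S = generatorOver S (allFin n)

  module Generator {S : Subset n} (I : Ideal S) where
    open IsGeneratorOver (generatorOver-correct I (allFin n)) public using () renaming (∣n to generator∣n)

    ∈⇒generator∣ : ∀ y → y ∈ₛ S → generator S ∣ toℕ y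
    ∈⇒generator∣ y = IsGeneratorOver.∣elements (generatorOver-correct I (allFin n)) (∈-allFin y)

    generator∣⇒∈ : ∀ y → generator S ∣ toℕ y → y ∈ₛ S
    generator∣⇒∈ y (divides c y≡cg) = subst (_∈ₛ S) cg≡y (Ideal.*-closed I (ι c) _ (IsGeneratorOver.∈ideal (generatorOver-correct I (allFin n))))
      where cg≡y : ι c *ₙ ι (generator S) ≡ y
            cg≡y = trans (ι-* c (generator S)) (trans (cong ι (sym y≡cg)) (ι-toℕ y))

  generator-injective : ∀ {S S'} → Ideal S → Ideal S' → generator S ≡ generator S' → S ≡ S'
  generator-injective {S} {S'} I I' g≡g' = lookup-extensional S S' same
    where
    same : ∀ x → lookup S x ≡ lookup S' x
    same x with lookup S x in x∈S | lookup S' x in x∈S'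
    ... | true | true = refl
    ... | false | false = refl
    ... | true | false = sym (trans (sym x∈S') (Generator.generator∣⇒∈ I' x (subst (_∣ toℕ x) g≡g' (Generator.∈⇒generator∣ I x x∈S))))
    ... | false | true = trans (sym x∈S) (Generator.generator∣⇒∈ I x (subst (_∣ toℕ x) (sym g≡g') (Generator.∈⇒generator∣ I' x x∈S')))

module Distances (n : ℕ) .{{_ : NonZero n}} where
  open ℤₙ n

  walk-0⇒≡ : ∀ {u v} → Walk u v 0 → u ≡ v
  walk-0⇒≡ (here _) = refl

  walk-1⇒Adj : ∀ {u v} → Walk u v 1 → Adj u v
  walk-1⇒Adj (step u~v (here _)) = u~v

  Adj⇒Dist1 : ∀ {u v} → Adj u v → Dist u v 1
  Adj⇒Dist1 u~v@(_ , v-vertex , u≢v , _) = step u~v (here v-vertex) , shortest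
    where shortest : ∀ j → Walk _ _ j → 1 ≤ j
          shortest zero w = ⊥-elim (u≢v (walk-0⇒≡ w))
          shortest (suc j) w = s≤s z≤n

  commonNeighbour⇒Dist2 : ∀ {u v z} → IsVertex v → u ≢ v → ¬ Adj u v → Adj u z → Adj z v → Dist u v 2
  commonNeighbour⇒Dist2 v-vertex u≢v u≁v u~z z~v = step u~z (step z~v (here v-vertex)) , shortest
    where shortest : ∀ j → Walk _ _ j → 2 ≤ j
          shortest zero w = ⊥-elim (u≢v (walk-0⇒≡ w))
          shortest (suc zero) w = ⊥-elim (u≁v (walk-1⇒Adj w))
          shortest (suc (suc j)) w = s≤s (s≤s z≤n)

  Dist-functional : ∀ {u v a b} → Dist u v a → Dist u v b → a ≡ b
  Dist-functional (wa , a-min) (wb , b-min) = ≤-antisym (a-min _ wb) (b-min _ wa)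

module EssentialGraph (k : ℕ) (p m : Fin k → ℕ) (p-prime : ∀ i → Prime (p i))
                      (p-coprime : ∀ i j → i ≢ j → Coprime (p i) (p j)) (m≥1 : ∀ i → 1 ≤ m i) where
  open Factorisation k p m p-prime p-coprime m≥1 public

  instance
    N-nonZero : NonZero N
    N-nonZero = >-nonZero (prodPow>0 m)

  open ℤₙ N public
  open IdealsOfℤₙ N public
  open Distances N public

  toℕ-0ₙ : toℕ 0ₙ ≡ 0
  toℕ-0ₙ = toℕ-ι< (prodPow>0 m)

  N∣toℕ⇒≡0 : ∀ (y : Fin N) → N ∣ toℕ y → toℕ y ≡ 0
  N∣toℕ⇒≡0 y (divides zero y≡0) = y≡0
  N∣toℕ⇒≡0 y (divides (suc c) y≡N+cN) = ⊥-elim (<⇒≱ (toℕ<n y) (subst (N ≤_) (sym y≡N+cN) (m≤m+n N (c * N))))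

  ∣toℕ-+ₙ : ∀ {d} → d ∣ N → ∀ x y → d ∣ toℕ x → d ∣ toℕ y → d ∣ toℕ (x +ₙ y)
  ∣toℕ-+ₙ d∣N x y d∣x d∣y = subst (_ ∣_) (sym (toℕ-ι _)) (%-presˡ-∣ (∣m∣n⇒∣m+n d∣x d∣y) d∣N)

  ∣toℕ-*ₙ : ∀ {d} → d ∣ N → ∀ r x → d ∣ toℕ x → d ∣ toℕ (r *ₙ x)
  ∣toℕ-*ₙ d∣N r x d∣x = subst (_ ∣_) (sym (toℕ-ι _)) (%-presˡ-∣ (∣n⇒∣m*n (toℕ r) d∣x) d∣N)

  nonzero⁻ : ∀ S → nonzeroᵇ S ≡ true → ∃[ y ] (y ∈ₛ S × toℕ y ≢ 0)
  nonzero⁻ S h = let (y , y∈∧≢0) = anyᶠ-true⁻ _ h in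
    y , ∧-conicalˡ (lookup S y) _ y∈∧≢0 , ≢0 (toℕ y) (subst (λ z → not (toℕ y ≡ᵇ z) ≡ true) toℕ-0ₙ (∧-conicalʳ (lookup S y) _ y∈∧≢0))
    where ≢0 : ∀ x → not (x ≡ᵇ 0) ≡ true → x ≢ 0
          ≢0 zero () refl

  nonzero⁺ : ∀ S y → y ∈ₛ S → toℕ y ≢ 0 → nonzeroᵇ S ≡ true
  nonzero⁺ S y y∈ y≢0 = anyᶠ-true⁺ _ y (cong₂ _∧_ y∈ (subst (λ z → not (toℕ y ≡ᵇ z) ≡ true) (sym toℕ-0ₙ) (≢0 (toℕ y) y≢0)))
    where ≢0 : ∀ x → x ≢ 0 → not (x ≡ᵇ 0) ≡ true
          ≢0 zero x≢0 = ⊥-elim (x≢0 refl)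
          ≢0 (suc x) _ = refl

  ∈⊕⁺ : ∀ I J a b → a ∈ₛ I → b ∈ₛ J → a +ₙ b ∈ₛ I ⊕ J
  ∈⊕⁺ I J a b a∈ b∈ = trans (lookup∘tabulate _ (a +ₙ b))
    (anyᶠ-true⁺ _ a (anyᶠ-true⁺ _ b (cong₂ _∧_ a∈ (cong₂ _∧_ b∈ (Equivalence.to Boolₚ.T-≡ (≡⇒≡ᵇ (toℕ (a +ₙ b)) _ refl))))))

  ∈⊕⁻ : ∀ I J x → x ∈ₛ I ⊕ J → ∃[ a ] ∃[ b ] (a ∈ₛ I × b ∈ₛ J × a +ₙ b ≡ x)
  ∈⊕⁻ I J x x∈ with anyᶠ-true⁻ _ (trans (sym (lookup∘tabulate _ x)) x∈)
  ... | a , ∃b with anyᶠ-true⁻ _ ∃b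
  ... | b , h = a , b , ∧-conicalˡ (lookup I a) _ h , ∧-conicalˡ (lookup J b) _ rest ,
                toℕ-injective (≡ᵇ⇒≡ _ _ (Equivalence.from Boolₚ.T-≡ (∧-conicalʳ (lookup J b) _ rest)))
    where rest = ∧-conicalʳ (lookup I a) _ h

  ∈∩⁺ : ∀ I J x → x ∈ₛ I → x ∈ₛ J → x ∈ₛ I ∩ J
  ∈∩⁺ I J x x∈I x∈J = trans (lookup∘tabulate _ x) (cong₂ _∧_ x∈I x∈J)

  ∈∩⁻ : ∀ I J x → x ∈ₛ I ∩ J → x ∈ₛ I × x ∈ₛ J
  ∈∩⁻ I J x x∈ = let h = trans (sym (lookup∘tabulate _ x)) x∈ in ∧-conicalˡ (lookup I x) _ h , ∧-conicalʳ (lookup I x) _ h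

  +ₙ-identityʳ : ∀ x → x +ₙ 0ₙ ≡ x
  +ₙ-identityʳ x = trans (cong (λ z → ι (toℕ x + z)) toℕ-0ₙ) (trans (cong ι (+-identityʳ (toℕ x))) (ι-toℕ x))

  +ₙ-identityˡ : ∀ x → 0ₙ +ₙ x ≡ x
  +ₙ-identityˡ x = trans (cong (λ z → ι (z + toℕ x)) toℕ-0ₙ) (ι-toℕ x)

  ⟨_⟩ : ℕ → Subset N
  ⟨ d ⟩ = tabulate (λ y → does (d ∣? toℕ y))

  ∈⟨⟩⁻ : ∀ d y → y ∈ₛ ⟨ d ⟩ → d ∣ toℕ y
  ∈⟨⟩⁻ d y y∈ with d ∣? toℕ y | trans (sym (lookup∘tabulate (λ y → does (d ∣? toℕ y)) y)) y∈
  ... | yes d∣y | _ = d∣y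

  ∈⟨⟩⁺ : ∀ d y → d ∣ toℕ y → y ∈ₛ ⟨ d ⟩
  ∈⟨⟩⁺ d y d∣y = trans (lookup∘tabulate _ y) (dec-true (d ∣? toℕ y) d∣y)

  ∉⟨⟩ : ∀ d y → ¬ d ∣ toℕ y → lookup ⟨ d ⟩ y ≡ false
  ∉⟨⟩ d y d∤y = trans (lookup∘tabulate _ y) (dec-false (d ∣? toℕ y) d∤y)

  ⟨⟩-ideal : ∀ d → d ∣ N → Ideal ⟨ d ⟩
  ⟨⟩-ideal d d∣N = record
    { 0∈ = ∈⟨⟩⁺ d 0ₙ (subst (d ∣_) (sym toℕ-0ₙ) (d ∣0))
    ; +-closed = λ x y x∈ y∈ → ∈⟨⟩⁺ d _ (∣toℕ-+ₙ d∣N x y (∈⟨⟩⁻ d x x∈) (∈⟨⟩⁻ d y y∈))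
    ; *-closed = λ r x x∈ → ∈⟨⟩⁺ d _ (∣toℕ-*ₙ d∣N r x (∈⟨⟩⁻ d x x∈)) }

  ⟨⟩-injective : ∀ {d d'} → d < N → d' < N → ⟨ d ⟩ ≡ ⟨ d' ⟩ → d ≡ d'
  ⟨⟩-injective {d} {d'} d<N d'<N ⟨d⟩≡⟨d'⟩ = ∣-antisym (∣generator d' d d'<N (sym ⟨d⟩≡⟨d'⟩)) (∣generator d d' d<N ⟨d⟩≡⟨d'⟩)
    where
    ∣generator : ∀ x y → x < N → ⟨ x ⟩ ≡ ⟨ y ⟩ → y ∣ x
    ∣generator x y x<N e = subst (y ∣_) (toℕ-ι< x<N)
      (∈⟨⟩⁻ y (ι x) (subst (ι x ∈ₛ_) e (∈⟨⟩⁺ x (ι x) (subst (x ∣_) (sym (toℕ-ι< x<N)) ∣-refl))))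

  cofactor<N : ∀ j → cofactor j < N
  cofactor<N j = subst (cofactor j <_) (sym (N≡p*cofactor j))
    (subst (_< p j * cofactor j) (*-identityˡ _) (*-monoˡ-< (cofactor j) {{>-nonZero (cofactor>0 j)}} (p>1 j)))

  -- ε j = N / p j spans the minimal ideal of ℤ_N belonging to p j.
  ε : Fin k → Fin N
  ε j = ι (cofactor j)

  toℕ-ε : ∀ j → toℕ (ε j) ≡ cofactor j
  toℕ-ε j = toℕ-ι< (cofactor<N j)

  toℕ-ε≢0 : ∀ j → toℕ (ε j) ≢ 0
  toℕ-ε≢0 j ε≡0 = <⇒≢ (cofactor>0 j) (sym (trans (sym (toℕ-ε j)) ε≡0))

  hasMinimal : Subset N → Fin k → Bool
  hasMinimal S j = lookup S (ε j)

  module _ {S : Subset N} (I : Ideal S) where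
    open Generator I

    ε∈⇒primePower∤generator : ∀ j → ε j ∈ₛ S → ¬ primePower j ∣ generator S
    ε∈⇒primePower∤generator j ε∈ pp∣g =
      primePower∤cofactor j (∣-trans pp∣g (subst (generator S ∣_) (toℕ-ε j) (∈⇒generator∣ (ε j) ε∈)))

    primePower∤generator⇒ε∈ : ∀ j → ¬ primePower j ∣ generator S → ε j ∈ₛ S
    primePower∤generator⇒ε∈ j pp∤g =
      generator∣⇒∈ (ε j) (subst (generator S ∣_) (sym (toℕ-ε j)) (∣N∧primePower∤⇒∣cofactor j generator∣n pp∤g))

    ∈∧primePower∤⇒ε∈ : ∀ j x → x ∈ₛ S → ¬ primePower j ∣ toℕ x → ε j ∈ₛ S
    ∈∧primePower∤⇒ε∈ j x x∈ pp∤x = primePower∤generator⇒ε∈ j (λ pp∣g → pp∤x (∣-trans pp∣g (∈⇒generator∣ x x∈)))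

    nonzero⇒∃ε∈ : nonzeroᵇ S ≡ true → ∃[ j ] (ε j ∈ₛ S)
    nonzero⇒∃ε∈ S-nonzero with nonzero⁻ S S-nonzero
    ... | y , y∈ , y≢0 with ¬∀⟶∃¬ k (λ j → primePower j ∣ toℕ y) (λ j → primePower j ∣? toℕ y)
                                     (λ pp∣y → y≢0 (N∣toℕ⇒≡0 y (primePowers∣⇒N∣ pp∣y)))
    ... | j , pp∤y = j , ∈∧primePower∤⇒ε∈ j y y∈ pp∤y

  Covers : Subset N → Subset N → Set
  Covers I J = ∀ j → ε j ∈ₛ I ⊎ ε j ∈ₛ J

  ⟨cofactor⟩-isIdeal : ∀ j → IsIdeal ⟨ cofactor j ⟩
  ⟨cofactor⟩-isIdeal j = Ideal⇒isIdeal ⟨ cofactor j ⟩ (⟨⟩-ideal (cofactor j) (cofactor∣N j))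

  ⟨cofactor⟩-nonzero : ∀ j → nonzeroᵇ ⟨ cofactor j ⟩ ≡ true
  ⟨cofactor⟩-nonzero j = nonzero⁺ ⟨ cofactor j ⟩ (ε j) (∈⟨⟩⁺ (cofactor j) (ε j) (subst (cofactor j ∣_) (sym (toℕ-ε j)) ∣-refl)) (toℕ-ε≢0 j)

  -- (I ⊕ J) ∩ ⟨N / p j⟩ contains some z = a + b ≢ 0; p j ^ m j cannot divide both a and b, as then N ∣ z.
  essential⇒covers : ∀ {I J} → Ideal I → Ideal J → Essential (I ⊕ J) → Covers I J
  essential⇒covers {I} {J} I-ideal J-ideal ess j =
    fromWitness (nonzero⁻ ((I ⊕ J) ∩ ⟨ cofactor j ⟩) (ess ⟨ cofactor j ⟩ (⟨cofactor⟩-isIdeal j) (⟨cofactor⟩-nonzero j)))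
    where
    fromWitness : ∃[ z ] (z ∈ₛ (I ⊕ J) ∩ ⟨ cofactor j ⟩ × toℕ z ≢ 0) → ε j ∈ₛ I ⊎ ε j ∈ₛ J
    fromWitness (z , z∈ , z≢0) = fromSummands (∈⊕⁻ I J z (proj₁ z∈∩))
      where
      z∈∩ = ∈∩⁻ (I ⊕ J) ⟨ cofactor j ⟩ z z∈
      fromSummands : ∃[ a ] ∃[ b ] (a ∈ₛ I × b ∈ₛ J × a +ₙ b ≡ z) → ε j ∈ₛ I ⊎ ε j ∈ₛ J
      fromSummands (a , b , a∈ , b∈ , a+b≡z) with primePower j ∣? toℕ a | primePower j ∣? toℕ b
      ... | no pp∤a | _ = inj₁ (∈∧primePower∤⇒ε∈ I-ideal j a a∈ pp∤a)
      ... | yes _ | no pp∤b = inj₂ (∈∧primePower∤⇒ε∈ J-ideal j b b∈ pp∤b)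
      ... | yes pp∣a | yes pp∣b = ⊥-elim (z≢0 (N∣toℕ⇒≡0 z (cofactor∣∧primePower∣⇒N∣ j (∈⟨⟩⁻ (cofactor j) z (proj₂ z∈∩)) pp∣z)))
        where pp∣z : primePower j ∣ toℕ z
              pp∣z = subst (λ w → primePower j ∣ toℕ w) a+b≡z (∣toℕ-+ₙ (primePower∣N j) a b pp∣a pp∣b)

  covers⇒essential : ∀ {I J} → Ideal I → Ideal J → Covers I J → Essential (I ⊕ J)
  covers⇒essential {I} {J} I-ideal J-ideal cover J' J'-isIdeal J'-nonzero =
    meet (nonzero⇒∃ε∈ (isIdeal⇒Ideal J' J'-isIdeal) J'-nonzero)
    where
    ε∈I⊕J : ∀ j → ε j ∈ₛ I ⊎ ε j ∈ₛ J → ε j ∈ₛ I ⊕ J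
    ε∈I⊕J j (inj₁ ε∈I) = subst (_∈ₛ I ⊕ J) (+ₙ-identityʳ (ε j)) (∈⊕⁺ I J (ε j) 0ₙ ε∈I (Ideal.0∈ J-ideal))
    ε∈I⊕J j (inj₂ ε∈J) = subst (_∈ₛ I ⊕ J) (+ₙ-identityˡ (ε j)) (∈⊕⁺ I J 0ₙ (ε j) (Ideal.0∈ I-ideal) ε∈J)
    meet : ∃[ j ] (ε j ∈ₛ J') → nonzeroᵇ ((I ⊕ J) ∩ J') ≡ true
    meet (j , ε∈J') = nonzero⁺ ((I ⊕ J) ∩ J') (ε j) (∈∩⁺ (I ⊕ J) J' (ε j) (ε∈I⊕J j (cover j)) ε∈J') (toℕ-ε≢0 j)

  vertex⇒ideal : ∀ {S} → IsVertex S → Ideal S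
  vertex⇒ideal {S} S-vertex = isIdeal⇒Ideal S (∧-conicalˡ (isIdealᵇ S) _ S-vertex)

  vertex⇒∃ε∈ : ∀ {S} → IsVertex S → ∃[ j ] (ε j ∈ₛ S)
  vertex⇒∃ε∈ {S} S-vertex = nonzero⇒∃ε∈ (vertex⇒ideal {S} S-vertex) (∧-conicalˡ (nonzeroᵇ S) _ (∧-conicalʳ (isIdealᵇ S) _ S-vertex))

  Adj⇒covers : ∀ {I J} → Adj I J → Covers I J
  Adj⇒covers {I} {J} (I-vertex , J-vertex , _ , ess) = essential⇒covers (vertex⇒ideal {I} I-vertex) (vertex⇒ideal {J} J-vertex) ess

  covers⇒Adj : ∀ {I J} → IsVertex I → IsVertex J → I ≢ J → Covers I J → Adj I J
  covers⇒Adj {I} {J} I-vertex J-vertex I≢J cover =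
    I-vertex , J-vertex , I≢J , covers⇒essential (vertex⇒ideal {I} I-vertex) (vertex⇒ideal {J} J-vertex) cover

  Adj-sym : ∀ {I J} → Adj I J → Adj J I
  Adj-sym {I} {J} I~J@(I-vertex , J-vertex , I≢J , _) = covers⇒Adj {J} {I} J-vertex I-vertex (I≢J ∘ sym) (swap ∘ Adj⇒covers {I} {J} I~J)

  prodPow<N : ∀ E → (∀ i → E i ≤ m i) → ∀ j → E j ≢ m j → prodPow E < N
  prodPow<N E E≤m j Ej≢mj = ≤∧≢⇒< (∣⇒≤ (prodPow∣N E E≤m))
    (λ E≡N → Ej≢mj (primePower∣prodPow⇒≡ E E≤m j (subst (primePower j ∣_) (sym E≡N) (primePower∣N j))))

  1<prodPow : ∀ E j → 1 ≤ E j → 1 < prodPow E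
  1<prodPow E j 1≤Ej = <-≤-trans (p>1 j) (≤-trans (p≤p^e j (E j) 1≤Ej) (∣⇒≤ {{>-nonZero (prodPow>0 E)}} (∣-prodFin k _ j)))

  ε∈⟨prodPow⟩ : ∀ E → (∀ i → E i ≤ m i) → ∀ j → E j ≢ m j → hasMinimal ⟨ prodPow E ⟩ j ≡ true
  ε∈⟨prodPow⟩ E E≤m j Ej≢mj = ∈⟨⟩⁺ (prodPow E) (ε j) (subst (prodPow E ∣_) (sym (toℕ-ε j))
    (∣N∧primePower∤⇒∣cofactor j (prodPow∣N E E≤m) (Ej≢mj ∘ primePower∣prodPow⇒≡ E E≤m j)))

  ε∉⟨prodPow⟩ : ∀ E j → E j ≡ m j → hasMinimal ⟨ prodPow E ⟩ j ≡ false
  ε∉⟨prodPow⟩ E j Ej≡mj = ∉⟨⟩ (prodPow E) (ε j)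
    (λ E∣ε → primePower∤cofactor j (∣-trans (≡⇒primePower∣prodPow E j Ej≡mj) (subst (prodPow E ∣_) (toℕ-ε j) E∣ε)))

  ⟨prodPow⟩-vertex : ∀ E → (∀ i → E i ≤ m i) → ∀ j → E j ≢ m j → ∀ j' → 1 ≤ E j' → IsVertex ⟨ prodPow E ⟩
  ⟨prodPow⟩-vertex E E≤m j Ej≢mj j' 1≤Ej' = cong₂ _∧_ isIdeal (cong₂ _∧_ nonzero proper)
    where
    d = prodPow E
    S = ⟨ d ⟩
    toℕ-ιd : toℕ (ι d) ≡ d
    toℕ-ιd = toℕ-ι< (prodPow<N E E≤m j Ej≢mj)
    isIdeal : isIdealᵇ S ≡ true
    isIdeal = Ideal⇒isIdeal S (⟨⟩-ideal d (prodPow∣N E E≤m))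
    nonzero : nonzeroᵇ S ≡ true
    nonzero = nonzero⁺ S (ι d) (∈⟨⟩⁺ d (ι d) (subst (d ∣_) (sym toℕ-ιd) ∣-refl))
                       (λ ιd≡0 → <⇒≢ (prodPow>0 E) (sym (trans (sym toℕ-ιd) ιd≡0)))
    d∤1 : ¬ d ∣ toℕ 1ₙ
    d∤1 d∣1 = <⇒≢ (1<prodPow E j' 1≤Ej') (sym (∣1⇒≡1 (subst (d ∣_) toℕ-1ₙ d∣1)))
      where toℕ-1ₙ : toℕ 1ₙ ≡ 1
            toℕ-1ₙ = toℕ-ι< (<-≤-trans (1<prodPow E j' 1≤Ej') (∣⇒≤ (prodPow∣N E E≤m)))
    proper : properᵇ S ≡ true
    proper = cong not (all-false⁺ (lookup S) (allFin N) (∈-allFin 1ₙ) (∉⟨⟩ d 1ₙ d∤1))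

  Covers? : ∀ u w → Dec (Covers u w)
  Covers? u w = all? (λ j → covers-at (hasMinimal u j) (hasMinimal w j))
    where covers-at : ∀ x y → Dec (x ≡ true ⊎ y ≡ true)
          covers-at true _ = yes (inj₁ refl)
          covers-at false true = yes (inj₂ refl)
          covers-at false false = no λ { (inj₁ ()) ; (inj₂ ()) }

  defect : Subset N → Subset k
  defect S = tabulate (not ∘ hasMinimal S)

  lookup-defect : ∀ S j → lookup (defect S) j ≡ not (hasMinimal S j)
  lookup-defect S j = lookup∘tabulate (not ∘ hasMinimal S) j

  defect≡⇒hasMinimal≡ : ∀ {S S'} → defect S ≡ defect S' → ∀ j → hasMinimal S j ≡ hasMinimal S' j
  defect≡⇒hasMinimal≡ {S} {S'} e j = not-injective (trans (sym (lookup-defect S j)) (trans (cong (λ D → lookup D j) e) (lookup-defect S' j)))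

  defect≡⇒covers : ∀ {S S' w} → defect S ≡ defect S' → Covers S w → Covers S' w
  defect≡⇒covers {S} {S'} e cover j = map₁ (trans (sym (defect≡⇒hasMinimal≡ {S} {S'} e j))) (cover j)

  vertex⇒defect≢⊤ : ∀ {S} → IsVertex S → defect S ≢ ⊤
  vertex⇒defect≢⊤ {S} S-vertex = contained (vertex⇒∃ε∈ {S} S-vertex)
    where
    contained : ∃[ j ] (ε j ∈ₛ S) → defect S ≢ ⊤
    contained (j , ε∈S) defect≡⊤ = Boolₚ.not-¬ {hasMinimal S j} {true} ε∈S (not-injective {hasMinimal S j} {false} notMin)
      where
      notMin : not (hasMinimal S j) ≡ true
      notMin = trans (sym (lookup-defect S j)) (trans (cong (λ D → lookup D j) defect≡⊤) (lookup-replicate j true))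

  hasMinimal≡not-defect : ∀ S j → hasMinimal S j ≡ not (lookup (defect S) j)
  hasMinimal≡not-defect S j = trans (sym (Boolₚ.not-involutive _)) (cong not (sym (lookup-defect S j)))

  defect≡⁅⁆∧ε∈⇒covers : ∀ {u w j} → defect w ≡ ⁅ j ⁆ → ε j ∈ₛ u → Covers u w
  defect≡⁅⁆∧ε∈⇒covers {u} {w} {j} w-lacks-j ε∈u j' with j' ≟ᶠ j
  ... | yes refl = inj₁ ε∈u
  ... | no j'≢j = inj₂ (trans (hasMinimal≡not-defect w j') (cong not (trans (cong (λ D → lookup D j') w-lacks-j) (lookup-⁅⁆-≢ j'≢j))))

  defect≡⁅⁆∧covers⇒ε∈ : ∀ {u w j} → defect w ≡ ⁅ j ⁆ → Covers u w → ε j ∈ₛ u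
  defect≡⁅⁆∧covers⇒ε∈ {u} {w} {j} w-lacks-j cover with cover j
  ... | inj₁ ε∈u = ε∈u
  ... | inj₂ ε∈w = ⊥-elim (true≢false (trans (sym ε∈w)
                     (trans (hasMinimal≡not-defect w j) (cong not (trans (cong (λ D → lookup D j) w-lacks-j) (lookup-⁅⁆ j))))))

  bump : Fin k → Fin k → ℕ
  bump l = updateAt (const 0) l (const 1)

  bump<m : ∀ l → 1 < m l → ∀ i → bump l i < m i
  bump<m l 1<mₗ i with i ≟ᶠ l
  ... | yes refl rewrite updateAt-updates l {const 1} (const 0) = 1<mₗ
  ... | no i≢l rewrite updateAt-minimal i l {const 1} (const 0) i≢l = m≥1 i

  module LackingOnly (B : Fin k → ℕ) (B<m : ∀ i → B i < m i) (j : Fin k) where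

    E : Fin k → ℕ
    E = updateAt B j (const (m j))

    Eⱼ≡mⱼ : E j ≡ m j
    Eⱼ≡mⱼ = updateAt-updates j {const (m j)} B

    E≡B : ∀ i → i ≢ j → E i ≡ B i
    E≡B i i≢j = updateAt-minimal i j {const (m j)} B i≢j

    E≤m : ∀ i → E i ≤ m i
    E≤m i with i ≟ᶠ j
    ... | yes refl = ≤-reflexive Eⱼ≡mⱼ
    ... | no i≢j = ≤-trans (≤-reflexive (E≡B i i≢j)) (<⇒≤ (B<m i))

    E≢m : ∀ i → i ≢ j → E i ≢ m i
    E≢m i i≢j = subst (_≢ m i) (sym (E≡B i i≢j)) (<⇒≢ (B<m i))

    lacking : Subset N
    lacking = ⟨ prodPow E ⟩

    lacking-defect : defect lacking ≡ ⁅ j ⁆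
    lacking-defect = lookup-extensional _ _ λ i → trans (lookup-defect lacking i) (at i)
      where
      at : ∀ i → not (hasMinimal lacking i) ≡ lookup ⁅ j ⁆ i
      at i with i ≟ᶠ j
      ... | yes refl = trans (cong not (ε∉⟨prodPow⟩ E j Eⱼ≡mⱼ)) (sym (lookup-⁅⁆ j))
      ... | no i≢j = trans (cong not (ε∈⟨prodPow⟩ E E≤m i (E≢m i i≢j))) (sym (lookup-⁅⁆-≢ i≢j))

    lacking-vertex : ∀ l → l ≢ j → IsVertex lacking
    lacking-vertex l l≢j = ⟨prodPow⟩-vertex E E≤m l (E≢m l l≢j) j (subst (1 ≤_) (sym Eⱼ≡mⱼ) (m≥1 j))

  -- ⟨p j ^ m j⟩ and ⟨p j ^ m j * p l⟩ are distinct vertices with the same defect ⁅ j ⁆.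
  lacking-distinct : ∀ j l → l ≢ j → (1<mₗ : 1 < m l) →
                     LackingOnly.lacking (const 0) (m≥1) j ≢ LackingOnly.lacking (bump l) (bump<m l 1<mₗ) j
  lacking-distinct j l l≢j 1<mₗ ⟨E⟩≡⟨E'⟩ = 1+n≰n (subst (1 ≤_) (E.E≡B l l≢j) (p^t∣prodPow⇒t≤ E.E l 1 pₗ∣E))
    where
    module E = LackingOnly (const 0) m≥1 j
    module E' = LackingOnly (bump l) (bump<m l 1<mₗ) j
    E≡E' : prodPow E.E ≡ prodPow E'.E
    E≡E' = ⟨⟩-injective (prodPow<N E.E E.E≤m l (E.E≢m l l≢j)) (prodPow<N E'.E E'.E≤m l (E'.E≢m l l≢j)) ⟨E⟩≡⟨E'⟩
    E'ₗ≡1 : E'.E l ≡ 1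
    E'ₗ≡1 = trans (E'.E≡B l l≢j) (updateAt-updates l {const 1} (const 0))
    pₗ∣E : p l ^ 1 ∣ prodPow E.E
    pₗ∣E = subst (p l ^ 1 ∣_) (sym E≡E') (subst (λ t → p l ^ t ∣ prodPow E'.E) E'ₗ≡1 (∣-prodFin k _ l))

  -- If m j = 1 for all j ≢ i, then the generator of an ideal without ε i is the product of
  -- the p j ^ m j over the missing ε j, so such vertices are determined by their defect.
  module OneSquarefulPrime (i : Fin k) (m≡1 : ∀ j → j ≢ i → m j ≡ 1) where

    primePower≡p : ∀ j → j ≢ i → primePower j ≡ p j
    primePower≡p j j≢i = trans (cong (p j ^_) (m≡1 j j≢i)) (*-identityʳ (p j))

    generator-∣ : ∀ {y w} → Ideal y → Ideal w → (∀ j → hasMinimal y j ≡ hasMinimal w j) → hasMinimal w i ≡ false →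
                  generator y ∣ generator w
    generator-∣ {y} {w} y-ideal w-ideal same ε∉w = ∣-trans gy∣missing missing∣gw
      where
      missing present : Fin k → ℕ
      missing j = if hasMinimal w j then 1 else primePower j
      present j = if hasMinimal w j then p j else 1
      ε∈w⇒≢i : ∀ {j} → hasMinimal w j ≡ true → j ≢ i
      ε∈w⇒≢i ε∈w refl = true≢false (trans (sym ε∈w) ε∉w)
      split : ∀ j → primePower j ≡ missing j * present j
      split j with hasMinimal w j in ε∈w?
      ... | false = sym (*-identityʳ (primePower j))
      ... | true = trans (primePower≡p j (ε∈w⇒≢i ε∈w?)) (sym (+-identityʳ (p j)))
      N≡present*missing : N ≡ prodFin k present * prodFin k missing
      N≡present*missing = trans (prodFin-cong k _ _ split) (trans (prodFin-* k missing present) (*-comm (prodFin k missing) _))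
      missing-coprime : ∀ j j' → j ≢ j' → Coprime (missing j) (missing j')
      missing-coprime j j' j≢j' with hasMinimal w j | hasMinimal w j'
      ... | true | _ = coprime-sym (coprime-1ʳ _)
      ... | false | true = coprime-1ʳ _
      ... | false | false = primePower-coprime j j' j≢j'
      missing∣gw : prodFin k missing ∣ generator w
      missing∣gw = pairwiseCoprime-∣⇒prodFin-∣ k missing missing-coprime missingⱼ∣gw
        where
        missingⱼ∣gw : ∀ j → missing j ∣ generator w
        missingⱼ∣gw j with hasMinimal w j in ε∈w?
        ... | true = 1∣ _
        ... | false with primePower j ∣? generator w
        ...   | yes pp∣gw = pp∣gw
        ...   | no pp∤gw = ⊥-elim (true≢false (trans (sym (primePower∤generator⇒ε∈ w-ideal j pp∤gw)) ε∈w?))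
      gy⊥present : ∀ j → Coprime (generator y) (present j)
      gy⊥present j with hasMinimal w j in ε∈w?
      ... | false = coprime-1ʳ _
      ... | true = coprime-sym (prime-∤⇒coprime (p-prime j) (λ p∣gy → ε∈⇒primePower∤generator y-ideal j (trans (same j) ε∈w?)
                      (subst (_∣ generator y) (sym (primePower≡p j (ε∈w⇒≢i ε∈w?))) p∣gy)))
      gy∣missing : generator y ∣ prodFin k missing
      gy∣missing = coprime-divisor (coprime-prodFin k present gy⊥present)
                     (subst (generator y ∣_) N≡present*missing (Generator.generator∣n y-ideal))

    defect≡⇒≡ : ∀ {y w} → IsVertex y → IsVertex w → defect y ≡ defect w → hasMinimal w i ≡ false → y ≡ w
    defect≡⇒≡ {y} {w} y-vertex w-vertex same-defect ε∉w =
      generator-injective y-ideal w-ideal (∣-antisym (generator-∣ y-ideal w-ideal same ε∉w)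
                                                     (generator-∣ w-ideal y-ideal (sym ∘ same) (trans (same i) ε∉w)))
      where
      y-ideal = vertex⇒ideal {y} y-vertex
      w-ideal = vertex⇒ideal {w} w-vertex
      same = defect≡⇒hasMinimal≡ {y} {w} same-defect

  -- The only place where some m i₀ > 1 is needed: the hub ⟨p i₀⟩ contains every ε j.
  module Hub (i₀ : Fin k) (1<m₀ : 1 < m i₀) where

    hubExp : Fin k → ℕ
    hubExp = bump i₀

    hubExp<m : ∀ i → hubExp i < m i
    hubExp<m = bump<m i₀ 1<m₀

    1≤hubExp₀ : 1 ≤ hubExp i₀
    1≤hubExp₀ = ≤-reflexive (sym (updateAt-updates i₀ {const 1} (const 0)))

    repExp : Subset k → Fin k → ℕ
    repExp D i = if lookup D i then m i else hubExp i

    repExp≤m : ∀ D i → repExp D i ≤ m i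
    repExp≤m D i with lookup D i
    ... | true = ≤-refl
    ... | false = <⇒≤ (hubExp<m i)

    rep : Subset k → Subset N
    rep D = ⟨ prodPow (repExp D) ⟩

    hasMinimal-rep : ∀ D j → hasMinimal (rep D) j ≡ not (lookup D j)
    hasMinimal-rep D j with lookup D j in j∈D
    ... | true = ε∉⟨prodPow⟩ (repExp D) j (cong (if_then m j else hubExp j) j∈D)
    ... | false = ε∈⟨prodPow⟩ (repExp D) (repExp≤m D) j (subst (λ b → (if b then m j else hubExp j) ≢ m j) (sym j∈D) (<⇒≢ (hubExp<m j)))

    defect-rep : ∀ D → defect (rep D) ≡ D
    defect-rep D = lookup-extensional _ D (λ j → trans (lookup-defect (rep D) j) (trans (cong not (hasMinimal-rep D j)) (Boolₚ.not-involutive _)))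

    rep-injective : ∀ {D D'} → rep D ≡ rep D' → D ≡ D'
    rep-injective {D} {D'} e = trans (sym (defect-rep D)) (trans (cong defect e) (defect-rep D'))

    rep-vertex : ∀ D j → lookup D j ≡ false → IsVertex (rep D)
    rep-vertex D j j∉D = ⟨prodPow⟩-vertex (repExp D) (repExp≤m D) j Ej≢mj i₀ 1≤E₀
      where
      Ej≢mj : repExp D j ≢ m j
      Ej≢mj = subst (λ b → (if b then m j else hubExp j) ≢ m j) (sym j∉D) (<⇒≢ (hubExp<m j))
      1≤E₀ : 1 ≤ repExp D i₀
      1≤E₀ with lookup D i₀
      ... | true = m≥1 i₀
      ... | false = 1≤hubExp₀

    hub : Subset N
    hub = rep ⊥

    ε∈hub : ∀ j → ε j ∈ₛ hub
    ε∈hub j = trans (hasMinimal-rep ⊥ j) (cong not (lookup-replicate j false))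

    hub-vertex : IsVertex hub
    hub-vertex = rep-vertex ⊥ i₀ (lookup-replicate i₀ false)

    hub-Adj : ∀ {v} → IsVertex v → hub ≢ v → Adj hub v
    hub-Adj {v} v-vertex hub≢v = covers⇒Adj {hub} {v} hub-vertex v-vertex hub≢v (inj₁ ∘ ε∈hub)

    covers⇒Dist1 : ∀ {u w} → IsVertex u → IsVertex w → u ≢ w → Covers u w → Dist u w 1
    covers⇒Dist1 {u} {w} u-vertex w-vertex u≢w cover = Adj⇒Dist1 (covers⇒Adj {u} {w} u-vertex w-vertex u≢w cover)

    ¬covers⇒Dist2 : ∀ {u w} → IsVertex u → IsVertex w → u ≢ w → ¬ Covers u w → Dist u w 2
    ¬covers⇒Dist2 {u} {w} u-vertex w-vertex u≢w ¬cover =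
      commonNeighbour⇒Dist2 w-vertex u≢w (¬cover ∘ Adj⇒covers {u} {w}) (Adj-sym {hub} {u} (hub-Adj u-vertex hub≢u)) (hub-Adj w-vertex hub≢w)
      where
      hub≢u : hub ≢ u
      hub≢u refl = ¬cover (inj₁ ∘ ε∈hub)
      hub≢w : hub ≢ w
      hub≢w refl = ¬cover (inj₂ ∘ ε∈hub)

    lacking⇒Dist : ∀ {u w j} → IsVertex u → IsVertex w → u ≢ w → defect w ≡ ⁅ j ⁆ → Dist u w (if hasMinimal u j then 1 else 2)
    lacking⇒Dist {u} {w} {j} u-vertex w-vertex u≢w w-lacks with hasMinimal u j in ε∈u?
    ... | true = covers⇒Dist1 u-vertex w-vertex u≢w (defect≡⁅⁆∧ε∈⇒covers {u} {w} w-lacks ε∈u?)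
    ... | false = ¬covers⇒Dist2 u-vertex w-vertex u≢w
                    (λ cover → true≢false (trans (sym (defect≡⁅⁆∧covers⇒ε∈ {u} {w} w-lacks cover)) ε∈u?))

    ∉∧∈⇒≢ : ∀ {x w} {W : List (Subset N)} → x ∉ W → w ∈ W → x ≢ w
    ∉∧∈⇒≢ x∉W w∈W refl = x∉W w∈W

    -- Whether u and w cover the socle depends on u only through its defect, hence so does d(u, w).
    resolving⇒defect-injective : ∀ {W} → Resolving W → ∀ {x x'} → IsVertex x → IsVertex x' → x ∉ W → x' ∉ W →
                                 defect x ≡ defect x' → x ≡ x'
    resolving⇒defect-injective {W} (W-vertices , _ , resolves) {x} {x'} x-vertex x'-vertex x∉W x'∉W same-defect
      with ≡-dec Boolₚ._≟_ x x'
    ... | yes x≡x' = x≡x'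
    ... | no x≢x' with resolves x x' x-vertex x'-vertex x∉W x'∉W x≢x'
    ... | w , w∈W , a , b , dist-a , dist-b , a≢b = ⊥-elim (a≢b (sameDistance (Covers? x w)))
      where
      w-vertex = All.lookup W-vertices w∈W
      x≢w = ∉∧∈⇒≢ x∉W w∈W
      x'≢w = ∉∧∈⇒≢ x'∉W w∈W
      sameDistance : Dec (Covers x w) → a ≡ b
      sameDistance (yes cover) =
        trans (Dist-functional dist-a (covers⇒Dist1 x-vertex w-vertex x≢w cover))
              (Dist-functional (covers⇒Dist1 x'-vertex w-vertex x'≢w (defect≡⇒covers {x} {x'} {w} same-defect cover)) dist-b)
      sameDistance (no ¬cover) =
        trans (Dist-functional dist-a (¬covers⇒Dist2 x-vertex w-vertex x≢w ¬cover))
              (Dist-functional (¬covers⇒Dist2 x'-vertex w-vertex x'≢w (¬cover ∘ defect≡⇒covers {x'} {x} {w} (sym same-defect))) dist-b)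

  _≟ₛ_ : DecidableEquality (Subset N)
  _≟ₛ_ = ≡-dec Boolₚ._≟_

  _≟ₖ_ : DecidableEquality (Subset k)
  _≟ₖ_ = ≡-dec Boolₚ._≟_

  open Remove _≟ₖ_ using (remove; ∈-remove⁺; ∈-remove⁻; length-remove; remove-unique) renaming (unique⊆⇒length≤ to unique⊆⇒length≤ₖ)
  open import Data.List.Membership.DecPropositional _≟ₛ_ using (_∈?_)

  nonfull : List (Subset k)
  nonfull = remove ⊤ (allSubsets k)

  nonfull-unique : Unique nonfull
  nonfull-unique = remove-unique (allSubsets-unique k)

  length-nonfull : length nonfull ≤ 2 ^ k ∸ 1
  length-nonfull = m+n≤o⇒m≤o∸n (length nonfull)
    (subst₂ _≤_ (+-comm 1 (length nonfull)) (length-allSubsets k) (length-remove (allSubsets k) (∈-allSubsets ⊤)))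

  ∈-nonfull : ∀ {D} → D ≢ ⊤ → D ∈ nonfull
  ∈-nonfull D≢⊤ = ∈-remove⁺ (∈-allSubsets _) D≢⊤

  module Vertices (T : ℕ) (enumeration : Fin T ↔ Vertex) where
    open Inverse enumeration

    vertices : List (Subset N)
    vertices = map (proj₁ ∘ to) (allFin T)

    ∈vertices⇒vertex : ∀ {x} → x ∈ vertices → IsVertex x
    ∈vertices⇒vertex x∈ with ∈-map⁻ (proj₁ ∘ to) x∈
    ... | t , _ , refl = proj₂ (to t)

    vertex⇒∈vertices : ∀ {x} → IsVertex x → x ∈ vertices
    vertex⇒∈vertices {x} x-vertex =
      subst (_∈ vertices) (cong proj₁ (strictlyInverseˡ (x , x-vertex))) (∈-map⁺ (proj₁ ∘ to) (∈-allFin (from (x , x-vertex))))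

    vertices-unique : Unique vertices
    vertices-unique = Uniqueₚ.map⁺ to-injective (Uniqueₚ.allFin⁺ T)
      where
      to-injective : ∀ {t t'} → proj₁ (to t) ≡ proj₁ (to t') → t ≡ t'
      to-injective {t} {t'} e = trans (sym (strictlyInverseʳ t)) (trans (cong from (Σ-≡ (proj₂ (to t)) (proj₂ (to t')) e)) (strictlyInverseʳ t'))
        where
        Σ-≡ : ∀ {S S'} (v : IsVertex S) (v' : IsVertex S') → S ≡ S' → (Vertex ∋ (S , v)) ≡ (S' , v')
        Σ-≡ v v' refl = cong (_ ,_) (Decidable⇒UIP.≡-irrelevant Boolₚ._≟_ v v')

    length-vertices : length vertices ≡ T
    length-vertices = trans (length-map _ (allFin T)) (length-tabulate _)

  module Dimension (i₀ : Fin k) (1<m₀ : 1 < m i₀) (T : ℕ) (enumeration : Fin T ↔ Vertex) where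
    open Hub i₀ 1<m₀ public
    open Vertices T enumeration

    -- A vertex outside W is recorded by its defect; by resolving⇒defect-injective this loses nothing.
    T≤|W|+|C| : ∀ {W} → Resolving W → (C : List (Subset k)) → (∀ v → IsVertex v → v ∉ W → defect v ∈ C) →
                T ≤ length W + length C
    T≤|W|+|C| {W} W-resolving C defect∈C = subst₂ _≤_ length-vertices length-record
      (Remove.injective⇒length≤ (Sumₚ.≡-dec _≟ₛ_ _≟ₖ_) record′ vertices records vertices-unique record-injective record∈)
      where
      record′ : Subset N → Subset N ⊎ Subset k
      record′ v with v ∈? W
      ... | yes _ = inj₁ v
      ... | no _ = inj₂ (defect v)
      records = map inj₁ W ++ map inj₂ C
      length-record : length records ≡ length W + length C
      length-record = trans (length-++ (map inj₁ W)) (cong₂ _+_ (length-map inj₁ W) (length-map inj₂ C))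
      record∈ : ∀ {x} → x ∈ vertices → record′ x ∈ records
      record∈ {x} x∈ with x ∈? W
      ... | yes x∈W = ∈-++⁺ˡ (∈-map⁺ inj₁ x∈W)
      ... | no x∉W = ∈-++⁺ʳ (map inj₁ W) (∈-map⁺ inj₂ (defect∈C x (∈vertices⇒vertex x∈) x∉W))
      record-injective : ∀ {x x'} → x ∈ vertices → x' ∈ vertices → record′ x ≡ record′ x' → x ≡ x'
      record-injective {x} {x'} x∈ x'∈ e with x ∈? W | x' ∈? W
      ... | yes _ | yes _ = Sumₚ.inj₁-injective e
      ... | no x∉W | no x'∉W = resolving⇒defect-injective W-resolving (∈vertices⇒vertex x∈) (∈vertices⇒vertex x'∈) x∉W x'∉W
                                                         (Sumₚ.inj₂-injective e)
      record-injective _ _ () | yes _ | no _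
      record-injective _ _ () | no _ | yes _

    lowerBound : ∀ {W} c (C : List (Subset k)) → Resolving W → (∀ v → IsVertex v → v ∉ W → defect v ∈ C) →
                 length C ≤ 2 ^ k ∸ c → T ∸ (2 ^ k ∸ c) ≤ length W
    lowerBound {W} c C W-resolving defect∈C |C|≤ = m≤n+o⇒m∸n≤o T (2 ^ k ∸ c) (begin
      T                       ≤⟨ T≤|W|+|C| W-resolving C defect∈C ⟩
      length W + length C     ≤⟨ +-monoʳ-≤ (length W) |C|≤ ⟩
      length W + (2 ^ k ∸ c)  ≡⟨ +-comm (length W) _ ⟩
      (2 ^ k ∸ c) + length W  ∎)
      where open ≤-Reasoning

    module ResolvingComplement (C : List (Subset k)) (C-nonfull : ∀ {D} → D ∈ C → D ≢ ⊤) (C-unique : Unique C)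
                               (witness : ∀ j → ∃[ w ] (IsVertex w × defect w ≡ ⁅ j ⁆ × w ∉ map rep C)) where

      reps : List (Subset N)
      reps = map rep C

      W : List (Subset N)
      W = filter (λ v → ¬? (v ∈? reps)) vertices

      ∈W⁺ : ∀ {v} → IsVertex v → v ∉ reps → v ∈ W
      ∈W⁺ v-vertex v∉reps = ∈-filter⁺ (λ v → ¬? (v ∈? reps)) (vertex⇒∈vertices v-vertex) v∉reps

      ∈W⁻ : ∀ {v} → v ∈ W → v ∈ vertices × v ∉ reps
      ∈W⁻ = ∈-filter⁻ (λ v → ¬? (v ∈? reps)) {xs = vertices}

      ∉W⇒rep : ∀ {u} → IsVertex u → u ∉ W → ∃[ D ] (u ≡ rep D)
      ∉W⇒rep {u} u-vertex u∉W with u ∈? reps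
      ... | no u∉reps = ⊥-elim (u∉W (∈W⁺ u-vertex u∉reps))
      ... | yes u∈reps with ∈-map⁻ rep u∈reps
      ...   | D , _ , u≡repD = D , u≡repD

      if-injective : ∀ x y → (if x then 1 else 2) ≡ (if y then 1 else 2) → x ≡ y
      if-injective true true _ = refl
      if-injective false false _ = refl

      -- Two representatives differ at some j, and the witness lacking only ε j separates them.
      separate : ∀ D D' → IsVertex (rep D) → IsVertex (rep D') → rep D ∉ W → rep D' ∉ W → rep D ≢ rep D' →
                 ∃[ w ] (w ∈ W × ∃[ a ] ∃[ b ] (Dist (rep D) w a × Dist (rep D') w b × a ≢ b))
      separate D D' repD-vertex repD'-vertex D∉W D'∉W repD≢repD'
        with ¬∀⟶∃¬ k (λ j → lookup D j ≡ lookup D' j) (λ j → lookup D j Boolₚ.≟ lookup D' j)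
             (λ same → repD≢repD' (cong rep (lookup-extensional D D' same)))
      ... | j , differ with witness j
      ... | w , w-vertex , w-lacks , w∉reps =
        w , w∈W , _ , _ , lacking⇒Dist repD-vertex w-vertex (∉∧∈⇒≢ D∉W w∈W) w-lacks ,
        lacking⇒Dist repD'-vertex w-vertex (∉∧∈⇒≢ D'∉W w∈W) w-lacks ,
        λ a≡b → differ (not-injective (trans (sym (hasMinimal-rep D j))
                          (trans (if-injective (hasMinimal (rep D) j) (hasMinimal (rep D') j) a≡b) (hasMinimal-rep D' j))))
        where
        w∈W = ∈W⁺ w-vertex w∉reps

      W-resolving : Resolving W
      W-resolving = W-vertices , Uniqueₚ.filter⁺ (λ v → ¬? (v ∈? reps)) vertices-unique , resolves
        where
        W-vertices : All IsVertex W
        W-vertices = All.tabulate (∈vertices⇒vertex ∘ proj₁ ∘ ∈W⁻)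
        resolves : ∀ u v → IsVertex u → IsVertex v → u ∉ W → v ∉ W → u ≢ v →
                   ∃[ w ] (w ∈ W × ∃[ a ] ∃[ b ] (Dist u w a × Dist v w b × a ≢ b))
        resolves u v u-vertex v-vertex u∉W v∉W u≢v with ∉W⇒rep u-vertex u∉W | ∉W⇒rep v-vertex v∉W
        ... | D , refl | D' , refl = separate D D' u-vertex v-vertex u∉W v∉W u≢v

      |W|+|C|≤T : length W + length C ≤ T
      |W|+|C|≤T = subst₂ _≤_ (trans (length-++ W) (cong (length W +_) (length-map rep C))) length-vertices
        (Remove.unique⊆⇒length≤ _≟ₛ_ (W ++ reps) vertices (Uniqueₚ.++⁺ W-unique reps-unique disjoint) ⊆vertices)
        where
        W-unique = Uniqueₚ.filter⁺ (λ v → ¬? (v ∈? reps)) vertices-unique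
        reps-unique : Unique reps
        reps-unique = Uniqueₚ.map⁺ rep-injective C-unique
        disjoint : ∀ {v} → ¬ (v ∈ W × v ∈ reps)
        disjoint (v∈W , v∈reps) = proj₂ (∈W⁻ v∈W) v∈reps
        ⊆vertices : ∀ {x} → x ∈ W ++ reps → x ∈ vertices
        ⊆vertices {x} x∈ with ∈-++⁻ W x∈
        ... | inj₁ x∈W = proj₁ (∈W⁻ x∈W)
        ... | inj₂ x∈reps with ∈-map⁻ rep x∈reps
        ...   | D , D∈C , refl with ¬∀⟶∃¬ k (λ j → lookup D j ≡ true) (λ j → lookup D j Boolₚ.≟ true)
                                         (λ full → C-nonfull D∈C (lookup-extensional D ⊤ (λ j → trans (full j) (sym (lookup-replicate j true)))))
        ...     | j , j∉D = vertex⇒∈vertices (rep-vertex D j (¬-not j∉D))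

      metricDim : ∀ c → (∀ W′ → Resolving W′ → T ∸ (2 ^ k ∸ c) ≤ length W′) → 2 ^ k ≤ c + length C → MetricDim (T ∸ (2 ^ k ∸ c))
      metricDim c lower 2^k≤c+|C| = (W , W-resolving , ≤-antisym |W|≤ (lower W W-resolving)) , lower
        where
        |W|≤ : length W ≤ T ∸ (2 ^ k ∸ c)
        |W|≤ = ≤-trans (m+n≤o⇒m≤o∸n (length W) |W|+|C|≤T) (∸-monoʳ-≤ T (m≤n+o⇒m∸n≤o (2 ^ k) c 2^k≤c+|C|))

    notBothReps : ∀ C {w₁ w₂} → w₁ ≢ w₂ → defect w₁ ≡ defect w₂ → w₁ ∉ map rep C ⊎ w₂ ∉ map rep C
    notBothReps C {w₁} {w₂} w₁≢w₂ same with w₁ ∈? map rep C | w₂ ∈? map rep C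
    ... | no w₁∉ | _ = inj₁ w₁∉
    ... | yes _ | no w₂∉ = inj₂ w₂∉
    ... | yes w₁∈ | yes w₂∈ with ∈-map⁻ rep w₁∈ | ∈-map⁻ rep w₂∈
    ...   | D₁ , _ , refl | D₂ , _ , refl = ⊥-elim (w₁≢w₂ (cong rep (trans (sym (defect-rep D₁)) (trans same (defect-rep D₂)))))

    lackingWitness : ∀ C j l → l ≢ j → 1 < m l → ∃[ w ] (IsVertex w × defect w ≡ ⁅ j ⁆ × w ∉ map rep C)
    lackingWitness C j l l≢j 1<mₗ = choose (notBothReps C (lacking-distinct j l l≢j 1<mₗ) (trans E.lacking-defect (sym E'.lacking-defect)))
      where
      module E = LackingOnly (const 0) m≥1 j
      module E' = LackingOnly (bump l) (bump<m l 1<mₗ) j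
      choose : E.lacking ∉ map rep C ⊎ E'.lacking ∉ map rep C → ∃[ w ] (IsVertex w × defect w ≡ ⁅ j ⁆ × w ∉ map rep C)
      choose (inj₁ w∉) = E.lacking , E.lacking-vertex l l≢j , E.lacking-defect , w∉
      choose (inj₂ w∉) = E'.lacking , E'.lacking-vertex l l≢j , E'.lacking-defect , w∉

    2^k≤|⊤∷C| : ∀ (C : List (Subset k)) → (∀ {D} → D ≢ ⊤ → D ∈ C) → 2 ^ k ≤ 1 + length C
    2^k≤|⊤∷C| C nonfull⊆C = subst (_≤ 1 + length C) (length-allSubsets k)
      (unique⊆⇒length≤ₖ (allSubsets k) (⊤ ∷ C) (allSubsets-unique k) ⊆⊤∷C)
      where
      ⊆⊤∷C : ∀ {D} → D ∈ allSubsets k → D ∈ ⊤ ∷ C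
      ⊆⊤∷C {D} _ with D ≟ₖ ⊤
      ... | yes refl = here refl
      ... | no D≢⊤ = there (nonfull⊆C D≢⊤)

    twoSquareful : ∀ i₁ i₂ → i₁ ≢ i₂ → 1 < m i₁ → 1 < m i₂ → MetricDim (T ∸ (2 ^ k ∸ 1))
    twoSquareful i₁ i₂ i₁≢i₂ 1<m₁ 1<m₂ = metricDim 1 lower (2^k≤|⊤∷C| nonfull ∈-nonfull)
      where
      witness : ∀ j → ∃[ w ] (IsVertex w × defect w ≡ ⁅ j ⁆ × w ∉ map rep nonfull)
      witness j with j ≟ᶠ i₁
      ... | yes refl = lackingWitness nonfull j i₂ (i₁≢i₂ ∘ sym) 1<m₂
      ... | no j≢i₁ = lackingWitness nonfull j i₁ (j≢i₁ ∘ sym) 1<m₁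
      open ResolvingComplement nonfull (proj₂ ∘ ∈-remove⁻ (allSubsets k)) nonfull-unique witness
      lower : ∀ W → Resolving W → T ∸ (2 ^ k ∸ 1) ≤ length W
      lower W W-resolving = lowerBound 1 nonfull W-resolving (λ v v-vertex _ → ∈-nonfull (vertex⇒defect≢⊤ {v} v-vertex)) length-nonfull

    outside? : ∀ W D → (∃[ v ] (IsVertex v × v ∉ W × defect v ≡ D)) ⊎ (∀ v → IsVertex v → v ∉ W → defect v ≢ D)
    outside? W D with Any.any? (λ v → ¬? (v ∈? W) ×-dec (defect v ≟ₖ D)) vertices
    ... | yes some = let (v , v∈ , v∉W , e) = find some in inj₁ (v , ∈vertices⇒vertex v∈ , v∉W , e)
    ... | no none = inj₂ (λ v v-vertex v∉W e → none (Any.map (λ { refl → v∉W , e }) (vertex⇒∈vertices v-vertex)))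

    missingClass⇒lowerBound : ∀ {W} → Resolving W → ∀ D → D ≢ ⊤ → (∀ v → IsVertex v → v ∉ W → defect v ≢ D) →
                              T ∸ (2 ^ k ∸ 2) ≤ length W
    missingClass⇒lowerBound W-resolving D D≢⊤ avoids = lowerBound 2 (remove D nonfull) W-resolving
      (λ v v-vertex v∉W → ∈-remove⁺ (∈-nonfull (vertex⇒defect≢⊤ {v} v-vertex)) (avoids v v-vertex v∉W))
      (subst (length (remove D nonfull) ≤_) (∸-+-assoc (2 ^ k) 1 1)
        (m+n≤o⇒m≤o∸n (length (remove D nonfull)) {1}
          (≤-trans (≤-reflexive (+-comm (length (remove D nonfull)) 1)) (≤-trans (length-remove nonfull (∈-nonfull D≢⊤)) length-nonfull))))

    -- If neither class ⊥ nor ⁅ i ⁆ lies inside W, the vertex of W separating a pair from these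
    -- two classes lacks ε i, so its whole class lies inside W.
    oneSquareful-lowerBound : ∀ i → (∀ j → j ≢ i → m j ≡ 1) → ∀ l → l ≢ i → ∀ W → Resolving W → T ∸ (2 ^ k ∸ 2) ≤ length W
    oneSquareful-lowerBound i m≡1 l l≢i W W-resolving@(W-vertices , _ , resolves) with outside? W ⊥ | outside? W ⁅ i ⁆
    ... | inj₂ avoids | _ = missingClass⇒lowerBound W-resolving ⊥ (⊥≢⊤ i) avoids
    ... | inj₁ _ | inj₂ avoids = missingClass⇒lowerBound W-resolving ⁅ i ⁆ (⁅⁆≢⊤ l≢i) avoids
    ... | inj₁ (u , u-vertex , u∉W , u-full) | inj₁ (x , x-vertex , x∉W , x-lacks) =
      resolverClass (resolves u x u-vertex x-vertex u∉W x∉W u≢x)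
      where
      open OneSquarefulPrime i m≡1
      u≢x : u ≢ x
      u≢x refl = ⊥≢⁅⁆ i (trans (sym u-full) x-lacks)
      resolverClass : ∃[ w ] (w ∈ W × ∃[ a ] ∃[ b ] (Dist u w a × Dist x w b × a ≢ b)) → T ∸ (2 ^ k ∸ 2) ≤ length W
      resolverClass (w , w∈W , a , b , dist-a , dist-b , a≢b) =
        missingClass⇒lowerBound W-resolving (defect w) (vertex⇒defect≢⊤ {w} w-vertex)
          (λ v v-vertex v∉W e → v∉W (subst (_∈ W) (sym (defect≡⇒≡ v-vertex w-vertex e ε∉w)) w∈W))
        where
        w-vertex = All.lookup W-vertices w∈W
        ε∈u : ∀ j → ε j ∈ₛ u
        ε∈u j = trans (hasMinimal≡not-defect u j) (cong not (trans (cong (λ D → lookup D j) u-full) (lookup-replicate j false)))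
        a≡1 : a ≡ 1
        a≡1 = Dist-functional dist-a (covers⇒Dist1 u-vertex w-vertex (∉∧∈⇒≢ u∉W w∈W) (inj₁ ∘ ε∈u))
        ε∉w : hasMinimal w i ≡ false
        ε∉w with hasMinimal w i in ε∈w?
        ... | false = refl
        ... | true = ⊥-elim (a≢b (trans a≡1 (Dist-functional (covers⇒Dist1 x-vertex w-vertex (∉∧∈⇒≢ x∉W w∈W) x-covers-w) dist-b)))
          where
          x-covers-w : Covers x w
          x-covers-w j with j ≟ᶠ i
          ... | yes refl = inj₂ ε∈w?
          ... | no j≢i = inj₁ (trans (hasMinimal≡not-defect x j) (cong not (trans (cong (λ D → lookup D j) x-lacks) (lookup-⁅⁆-≢ j≢i))))

    oneSquareful : ∀ i → 1 < m i → (∀ j → j ≢ i → m j ≡ 1) → ∀ l → l ≢ i → MetricDim (T ∸ (2 ^ k ∸ 2))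
    oneSquareful i 1<mᵢ m≡1 l l≢i = metricDim 2 (oneSquareful-lowerBound i m≡1 l l≢i) |C|+2≥2^k
      where
      module Eᵢ = LackingOnly (const 0) m≥1 i

      C : List (Subset k)
      C = remove ⁅ i ⁆ nonfull

      witness : ∀ j → ∃[ w ] (IsVertex w × defect w ≡ ⁅ j ⁆ × w ∉ map rep C)
      witness j with j ≟ᶠ i
      ... | no j≢i = lackingWitness C j i (j≢i ∘ sym) 1<mᵢ
      ... | yes refl = Eᵢ.lacking , Eᵢ.lacking-vertex l l≢i , Eᵢ.lacking-defect , not-rep
        where
        not-rep : Eᵢ.lacking ∉ map rep C
        not-rep w∈ with ∈-map⁻ rep w∈
        ... | D , D∈C , e = proj₂ (∈-remove⁻ nonfull D∈C) (trans (sym (defect-rep D)) (trans (cong defect (sym e)) Eᵢ.lacking-defect))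

      open ResolvingComplement C (proj₂ ∘ ∈-remove⁻ (allSubsets k) ∘ proj₁ ∘ ∈-remove⁻ nonfull) (remove-unique nonfull-unique) witness

      |C|+2≥2^k : 2 ^ k ≤ 2 + length C
      |C|+2≥2^k = 2^k≤|⊤∷C| (⁅ i ⁆ ∷ C) nonfull⊆
        where
        nonfull⊆ : ∀ {D} → D ≢ ⊤ → D ∈ ⁅ i ⁆ ∷ C
        nonfull⊆ {D} D≢⊤ with D ≟ₖ ⁅ i ⁆
        ... | yes refl = here refl
        ... | no D≢⁅i⁆ = there (∈-remove⁺ (∈-nonfull D≢⊤) D≢⁅i⁆)

mainTheorem8 : (k : ℕ) (p m : Fin k → ℕ) (n : ℕ) .{{_ : NonZero n}} →
    2 ≤ k →
    (∀ i → Prime (p i)) →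
    (∀ i j → i <ᶠ j → p i < p j) →
    (∀ i → 1 ≤ m i) →
    (∃[ i ] (1 < m i)) →
    n ≡ prodFin k (λ i → p i ^ m i) →
    (T : ℕ) → (Fin T ↔ ℤₙ.Vertex n) →
    ((∃[ i ] ∃[ j ] (i ≢ j × 1 < m i × 1 < m j)) →
        ℤₙ.MetricDim n (T ∸ (2 ^ k ∸ 1)))
    ×
    ((∃[ i ] (1 < m i × (∀ j → j ≢ i → m j ≡ 1))) →
        ℤₙ.MetricDim n (T ∸ (2 ^ k ∸ 2)))
mainTheorem8 k p m _ 2≤k p-prime p-increasing m≥1 (i₀ , 1<m₀) refl T enumeration =
  (λ { (i₁ , i₂ , i₁≢i₂ , 1<m₁ , 1<m₂) → twoSquareful i₁ i₂ i₁≢i₂ 1<m₁ 1<m₂ }) ,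
  (λ { (i , 1<mᵢ , m≡1) → let (l , l≢i) = otherIndex 2≤k i in oneSquareful i 1<mᵢ m≡1 l l≢i })
  where
  p-coprime : ∀ i j → i ≢ j → Coprime (p i) (p j)
  p-coprime i j i≢j = prime-≢⇒coprime (p-prime i) (p-prime j) (increasing⇒injective p-increasing i j i≢j)
  open EssentialGraph k p m p-prime p-coprime m≥1
  open Dimension i₀ 1<m₀ T enumeration
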